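{- If $G$ is a $4$-critical non-complete graph, then $G$ contains at most $m(G)/2$ double-critical edges. Moreover, $G$ contains precisely $m(G)/2$ double-critical edges if and only if $G$ contains a vertex $v$ of degree $n(G)-1$ such that $G-v$ is an odd cycle of length at least $5$.
   Context: All graphs are finite and simple; $n(G)$ and $m(G)$ denote the number of vertices and edges of $G$. A graph is $k$-critical if it is $k$-chromatic and $\chi(G-v)<\chi(G)$ for every vertex $v$. An edge $xy$ of $G$ is double-critical if $\chi(G-x-y)=\chi(G)-2$, where $G-x-y$ denotes deletion of both end-vertices. -}

module Defs where

open import Level using (_⊔_)
open import Data.Bool using (Bool; true; false; T; _∧_)
open import Data.Nat using (ℕ; zero; suc; _∸_; _<ᵇ_; _%_; _<_)
open import Data.Fin using (Fin; toℕ)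
open import Data.List using (List; length; filterᵇ; allFin; cartesianProduct)
open import Data.Product using (_×_; _,_; Σ; ∃)
open import Data.Unit using (⊤)
open import Data.Sum using (_⊎_)
open import Relation.Nullary using (¬_)
open import Relation.Binary.PropositionalEquality using (_≡_; _≢_)
open import Function.Bundles using (_↔_; _⇔_)

record Graph (n : ℕ) : Set where
  field
    adj    : Fin n → Fin n → Bool
    sym    : ∀ u v → adj u v ≡ adj v u
    irrefl : ∀ v → adj v v ≡ false
open Graph public

-- Subset type whose membership proof is irrelevant, so its elements are
-- determined by the underlying element (used for counting).
record Sub {a p} (A : Set a) (P : A → Set p) : Set (a ⊔ p) where
  constructor ⟨_,_⟩
  field
    elt   : A
    .prf  : P elt
open Sub public

HasSize : ∀ {a} → Set a → ℕ → Set a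
HasSize A d = Fin d ↔ A

-- Vertex sets of induced subgraphs, given as predicates on Fin n.
VSet : ℕ → Set₁
VSet n = Fin n → Set

allV : ∀ {n} → VSet n
allV _ = ⊤

minus1 : ∀ {n} → Fin n → VSet n
minus1 v u = u ≢ v

minus2 : ∀ {n} → Fin n → Fin n → VSet n
minus2 x y u = (u ≢ x) × (u ≢ y)

Colourable : ∀ {n} → Graph n → VSet n → ℕ → Set
Colourable {n} G S k =
  Σ ((v : Fin n) → S v → Fin k) λ c →
    ∀ u v (su : S u) (sv : S v) → T (adj G u v) → c u su ≢ c v sv

HasChromatic : ∀ {n} → Graph n → VSet n → ℕ → Set
HasChromatic G S k = Colourable G S k × (∀ j → j < k → ¬ Colourable G S j)

Critical : ∀ {n} → ℕ → Graph n → Set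
Critical {n} k G =
  HasChromatic G allV k ×
  (∀ (v : Fin n) → ∃ λ j → j < k × HasChromatic G (minus1 v) j)

DoubleCritical : ∀ {n} → Graph n → Fin n → Fin n → Set
DoubleCritical G x y =
  T (adj G x y) × ∃ λ k → HasChromatic G allV k × HasChromatic G (minus2 x y) (k ∸ 2)

-- double-critical edges, each edge represented once as (x , y) with x < y
DCEdge : ∀ {n} → Graph n → Set
DCEdge {n} G = Sub (Fin n × Fin n) λ { (x , y) → toℕ x < toℕ y × DoubleCritical G x y }

edgeCount : ∀ {n} → Graph n → ℕ
edgeCount {n} G =
  length (filterᵇ (λ { (x , y) → (toℕ x <ᵇ toℕ y) ∧ adj G x y })
                  (cartesianProduct (allFin n) (allFin n)))

degree : ∀ {n} → Graph n → Fin n → ℕ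
degree {n} G v = length (filterᵇ (adj G v) (allFin n))

NonComplete : ∀ {n} → Graph n → Set
NonComplete G = ∃ λ x → ∃ λ y → x ≢ y × ¬ T (adj G x y)

CycleAdj : (k : ℕ) → Fin (suc k) → Fin (suc k) → Set
CycleAdj k i j = (toℕ j ≡ suc (toℕ i) % suc k) ⊎ (toℕ i ≡ suc (toℕ j) % suc k)

GminusVIsCycle : ∀ {n} → Graph n → Fin n → ℕ → Set
GminusVIsCycle {n} G v k =
  Σ (Fin (suc k) ↔ Sub (Fin n) (minus1 v)) λ f →
    ∀ i j → T (adj G (elt (Inv.to f i)) (elt (Inv.to f j))) ⇔ CycleAdj k i j
  where module Inv = Function.Bundles.Inverse

GminusVIsOddCycle≥5 : ∀ {n} → Graph n → Fin n → Set
GminusVIsOddCycle≥5 G v =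
  ∃ λ k → 5 Data.Nat.≤ suc k × suc k % 2 ≡ 1 × GminusVIsCycle G v k

module Submission where

-- After counting tools (finite sums, the handshake lemma) and basic facts on
-- 4-critical graphs (not 3-colourable, every G - v is, minimum degree ≥ 3,
-- a double-critical edge xy yields a 2-colouring of G - x - y), we show that
-- two double-critical edges always meet: disjoint ones either combine into a
-- 3-colouring or span a K₄, and a 4-critical graph containing K₄ is K₄.
-- Pairwise meeting edges form a star or number at most 3.  For a star at v,
-- d ≤ deg v ≤ n - 1 and 2m ≥ deg v + 3(n - 1) give 2d ≤ m.  Equality forces
-- deg v = n - 1 and all other degrees 3; walking in G - v closes a cycle
-- that is odd (else a spoke is not double-critical) and spanning (else G is
-- 3-colourable).  Conversely, in an odd wheel exactly the spokes are
-- double-critical.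

open import Defs
open import Data.Nat
  using (ℕ; zero; suc; _+_; _*_; _≤_; _<_; _∸_; z≤n; s≤s; s≤s⁻¹; _<ᵇ_; _%_; _≤?_; _<?_)
import Data.Nat as ℕ
open import Data.Nat.Properties hiding (_≟_)
import Data.Nat.DivMod as DM
open import Data.Nat.Tactic.RingSolver using (solve-∀)
open import Data.Bool using (Bool; true; false; T; _∧_; not; if_then_else_)
open import Data.Bool.Properties using (T?; T-≡; ∧-zeroʳ; ∧-identityʳ)
open import Data.Fin using (Fin; zero; suc; toℕ; _≟_; inject≤; inject₁; fromℕ<; punchIn)
import Data.Fin.Properties as FP
open import Data.List using (List; []; _∷_; length; filterᵇ; allFin; cartesianProduct; tabulate; map; _++_)
open import Data.Product using (_×_; _,_; Σ; ∃; proj₁; proj₂)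
open import Data.Sum using (_⊎_; inj₁; inj₂)
open import Data.Empty using (⊥; ⊥-elim; ⊥-elim-irr)
open import Function using (_∘_; id)
open import Function.Bundles using (Inverse; _↔_; _⇔_; mk⇔; Equivalence)
open import Relation.Nullary using (¬_; Dec; yes; no; does)
open import Relation.Nullary.Decidable using (recompute; _×-dec_; _→-dec_; ¬?)
open import Relation.Unary using (Decidable)
open import Relation.Binary.Definitions using (tri<; tri≈; tri>)
open import Relation.Binary.PropositionalEquality hiding (sym)
open import Relation.Binary.PropositionalEquality using () renaming (sym to ≡-sym)

T⇒true : ∀ {b} → T b → b ≡ true
T⇒true = Equivalence.to T-≡

¬T⇒false : ∀ {b} → ¬ T b → b ≡ false
¬T⇒false {true} f = ⊥-elim (f _)
¬T⇒false {false} _ = refl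

-- Finite sums and counting over Fin n

∑ : ∀ {n} → (Fin n → ℕ) → ℕ
∑ {zero} f = 0
∑ {suc n} f = f zero + ∑ (f ∘ suc)

ind : Bool → ℕ
ind true = 1
ind false = 0

ind≤1 : ∀ b → ind b ≤ 1
ind≤1 true = s≤s z≤n
ind≤1 false = z≤n

count : ∀ {n} → (Fin n → Bool) → ℕ
count P = ∑ (λ i → ind (P i))

δ : ∀ {n} → Fin n → Fin n → Bool
δ a y = does (a ≟ y)

∑-ext : ∀ {n} {f g : Fin n → ℕ} → (∀ i → f i ≡ g i) → ∑ f ≡ ∑ g
∑-ext {zero} e = refl
∑-ext {suc n} e = cong₂ _+_ (e zero) (∑-ext (e ∘ suc))

∑-mono : ∀ {n} {f g : Fin n → ℕ} → (∀ i → f i ≤ g i) → ∑ f ≤ ∑ g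
∑-mono {zero} e = z≤n
∑-mono {suc n} e = +-mono-≤ (e zero) (∑-mono (e ∘ suc))

∑-+ : ∀ {n} (f g : Fin n → ℕ) → ∑ (λ i → f i + g i) ≡ ∑ f + ∑ g
∑-+ {zero} f g = refl
∑-+ {suc n} f g = begin
    f zero + g zero + ∑ (λ i → f (suc i) + g (suc i))
  ≡⟨ cong (f zero + g zero +_) (∑-+ (f ∘ suc) (g ∘ suc)) ⟩
    f zero + g zero + (∑ (f ∘ suc) + ∑ (g ∘ suc))
  ≡⟨ +-+-comm (f zero) (g zero) (∑ (f ∘ suc)) (∑ (g ∘ suc)) ⟩
    f zero + ∑ (f ∘ suc) + (g zero + ∑ (g ∘ suc)) ∎
  where
  open ≡-Reasoning
  +-+-comm : ∀ a b c d → a + b + (c + d) ≡ a + c + (b + d)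
  +-+-comm = solve-∀

∑-const : ∀ {n} c → ∑ {n} (λ _ → c) ≡ n * c
∑-const {zero} c = refl
∑-const {suc n} c = cong (c +_) (∑-const {n} c)

∑-*c : ∀ {n} (f : Fin n → ℕ) c → ∑ (λ i → f i * c) ≡ ∑ f * c
∑-*c {zero} f c = refl
∑-*c {suc n} f c = trans (cong (f zero * c +_) (∑-*c (f ∘ suc) c)) (≡-sym (*-distribʳ-+ c (f zero) (∑ (f ∘ suc))))

∑-swap : ∀ {m n} (f : Fin m → Fin n → ℕ) → ∑ (λ i → ∑ (λ j → f i j)) ≡ ∑ (λ j → ∑ (λ i → f i j))
∑-swap {zero} {n} f = ≡-sym (trans (∑-const {n} 0) (*-zeroʳ n))
∑-swap {suc m} {n} f = trans (cong (∑ (f zero) +_) (∑-swap (f ∘ suc))) (≡-sym (∑-+ (f zero) (λ j → ∑ (λ i → f (suc i) j))))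

count-δ : ∀ {n} (a : Fin n) → count (δ a) ≡ 1
count-δ {suc n} zero = cong suc (trans (∑-const {n} 0) (*-zeroʳ n))
count-δ (suc a) = count-δ a

∑-δ* : ∀ {n} (a : Fin n) c → ∑ (λ y → ind (δ a y) * c) ≡ c
∑-δ* a c = trans (∑-*c (λ y → ind (δ a y)) c) (trans (cong (_* c) (count-δ a)) (*-identityˡ c))

∑-split : ∀ {n} (f : Fin n → ℕ) a → ∑ f ≡ f a + ∑ (λ y → if δ a y then 0 else f y)
∑-split {n} f a = trans (∑-ext pointwise) (trans (∑-+ (λ y → ind (δ a y) * f a) rest) (cong (_+ ∑ rest) (∑-δ* a (f a))))
  where
  rest : Fin n → ℕ
  rest y = if δ a y then 0 else f y
  pointwise : ∀ y → f y ≡ ind (δ a y) * f a + (if δ a y then 0 else f y)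
  pointwise y with a ≟ y
  ... | yes refl = ≡-sym (trans (+-identityʳ _) (+-identityʳ _))
  ... | no _ = refl

count+2≤ : ∀ {n} (P : Fin n → Bool) a b → a ≢ b → P a ≡ false → P b ≡ false → suc (suc (count P)) ≤ n
count+2≤ {n} P a b ab Pa Pb = subst₂ _≤_ total (trans (∑-const {n} 1) (*-identityʳ n)) (∑-mono pointwise)
  where
  pointwise : ∀ z → ind (P z) + ind (δ a z) + ind (δ b z) ≤ 1
  pointwise z with a ≟ z | b ≟ z
  ... | yes refl | yes refl = ⊥-elim (ab refl)
  ... | yes refl | no _ rewrite Pa = s≤s z≤n
  ... | no _ | yes refl rewrite Pb = s≤s z≤n
  ... | no _ | no _ rewrite +-identityʳ (ind (P z)) | +-identityʳ (ind (P z)) = ind≤1 (P z)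
  total : ∑ (λ z → ind (P z) + ind (δ a z) + ind (δ b z)) ≡ suc (suc (count P))
  total = trans (∑-+ (λ z → ind (P z) + ind (δ a z)) (λ z → ind (δ b z)))
            (trans (cong₂ _+_ (trans (∑-+ (λ z → ind (P z)) (λ z → ind (δ a z))) (cong (count P +_) (count-δ a))) (count-δ b))
              (trans (+-assoc (count P) 1 1) (+-comm (count P) 2)))

count+1≤ : ∀ {n} (P : Fin n → Bool) a → P a ≡ false → suc (count P) ≤ n
count+1≤ {n} P a Pa = subst₂ _≤_ total (trans (∑-const {n} 1) (*-identityʳ n)) (∑-mono pointwise)
  where
  pointwise : ∀ z → ind (P z) + ind (δ a z) ≤ 1
  pointwise z with a ≟ z
  ... | yes refl rewrite Pa = s≤s z≤n
  ... | no _ rewrite +-identityʳ (ind (P z)) = ind≤1 (P z)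
  total : ∑ (λ z → ind (P z) + ind (δ a z)) ≡ suc (count P)
  total = trans (∑-+ (λ z → ind (P z)) (λ z → ind (δ a z))) (trans (cong (count P +_) (count-δ a)) (+-comm (count P) 1))

count-full : ∀ {n} (P : Fin n → Bool) a → P a ≡ false → n ≤ suc (count P) → ∀ y → a ≢ y → T (P y)
count-full P a Pa le y ay with T? (P y)
... | yes p = p
... | no np = ⊥-elim (<-irrefl refl (≤-trans (s≤s le) (count+2≤ P a y ay Pa (¬T⇒false np))))

rank : ∀ {n} (P : Fin n → Bool) (i : Fin n) → .(T (P i)) → Fin (count P)
rank {suc n} P zero p with P zero
... | true = zero
... | false = ⊥-elim-irr p
rank {suc n} P (suc i) p with P zero
... | true = suc (rank (P ∘ suc) i p)
... | false = rank (P ∘ suc) i p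

rank-injective : ∀ {n} (P : Fin n → Bool) (i j : Fin n) .(p : T (P i)) .(q : T (P j)) → rank P i p ≡ rank P j q → i ≡ j
rank-injective {suc n} P zero zero p q e = refl
rank-injective {suc n} P zero (suc j) p q e with P zero
rank-injective {suc n} P zero (suc j) p q () | true
... | false = ⊥-elim-irr p
rank-injective {suc n} P (suc i) zero p q e with P zero
rank-injective {suc n} P (suc i) zero p q () | true
... | false = ⊥-elim-irr q
rank-injective {suc n} P (suc i) (suc j) p q e with P zero
... | true = cong suc (rank-injective (P ∘ suc) i j p q (FP.suc-injective e))
... | false = cong suc (rank-injective (P ∘ suc) i j p q e)

count-≥ : ∀ {n d} (P : Fin n → Bool) (f : Fin d → Fin n) → (∀ i j → f i ≡ f j → i ≡ j) → (∀ i → T (P (f i))) → d ≤ count P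
count-≥ P f inj pf = FP.injective⇒≤ {f = λ k → rank P (f k) (pf k)} (λ {i} {j} e → inj i j (rank-injective P (f i) (f j) (pf i) (pf j) e))

-- Degrees, edge count and the handshake lemma

#filter : ∀ {a} {A : Set a} → (A → Bool) → List A → ℕ
#filter P xs = length (filterᵇ P xs)

#filter-tabulate : ∀ {a} {A : Set a} {n} (P : A → Bool) (g : Fin n → A) → #filter P (tabulate g) ≡ ∑ (λ i → ind (P (g i)))
#filter-tabulate {n = zero} P g = refl
#filter-tabulate {n = suc n} P g with P (g zero)
... | true = cong suc (#filter-tabulate P (g ∘ suc))
... | false = #filter-tabulate P (g ∘ suc)

#filter-++ : ∀ {a} {A : Set a} (P : A → Bool) (xs ys : List A) → #filter P (xs ++ ys) ≡ #filter P xs + #filter P ys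
#filter-++ P [] ys = refl
#filter-++ P (x ∷ xs) ys with P x
... | true = cong suc (#filter-++ P xs ys)
... | false = #filter-++ P xs ys

#filter-map : ∀ {a b} {A : Set a} {B : Set b} (P : B → Bool) (f : A → B) (xs : List A) → #filter P (map f xs) ≡ #filter (P ∘ f) xs
#filter-map P f [] = refl
#filter-map P f (x ∷ xs) with P (f x)
... | true = cong suc (#filter-map P f xs)
... | false = #filter-map P f xs

#filter-cartesianProduct : ∀ {a b} {A : Set a} {B : Set b} (Q : B × A → Bool) (m : ℕ) (ys : List A) (h : Fin m → B) →
  #filter Q (cartesianProduct (tabulate h) ys) ≡ ∑ (λ i → #filter (λ y → Q (h i , y)) ys)
#filter-cartesianProduct Q zero ys h = refl
#filter-cartesianProduct Q (suc m) ys h =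
  trans (#filter-++ Q (map (h zero ,_) ys) _)
        (cong₂ _+_ (#filter-map Q (h zero ,_) ys) (#filter-cartesianProduct Q m ys (h ∘ suc)))

_<ᶠ_ : ∀ {n} → Fin n → Fin n → Bool
x <ᶠ y = toℕ x <ᵇ toℕ y

up-degree : ∀ {n} → Graph n → Fin n → ℕ
up-degree G x = count (λ y → (x <ᶠ y) ∧ adj G x y)

down-degree : ∀ {n} → Graph n → Fin n → ℕ
down-degree G x = count (λ y → (y <ᶠ x) ∧ adj G y x)

degree≡count : ∀ {n} (G : Graph n) v → degree G v ≡ count (adj G v)
degree≡count G v = #filter-tabulate (adj G v) id

edgeCount≡∑up : ∀ {n} (G : Graph n) → edgeCount G ≡ ∑ (up-degree G)
edgeCount≡∑up {n} G =
  trans (#filter-cartesianProduct _ n (allFin n) id) (∑-ext (λ x → #filter-tabulate ((λ y → (x <ᶠ y) ∧ adj G x y)) id))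

adj≡up+down : ∀ {n} (G : Graph n) x y → ind (adj G x y) ≡ ind ((x <ᶠ y) ∧ adj G x y) + ind ((y <ᶠ x) ∧ adj G y x)
adj≡up+down G x y with <-cmp (toℕ x) (toℕ y)
... | tri< a _ c rewrite T⇒true (<⇒<ᵇ a) | ¬T⇒false (λ t → c (<ᵇ⇒< (toℕ y) (toℕ x) t)) = ≡-sym (+-identityʳ _)
... | tri> a _ c rewrite T⇒true (<⇒<ᵇ c) | ¬T⇒false (λ t → a (<ᵇ⇒< (toℕ x) (toℕ y) t)) | sym G x y = refl
... | tri≈ _ b _ rewrite FP.toℕ-injective b | irrefl G y | ∧-zeroʳ (y <ᶠ y) = refl

handshake : ∀ {n} (G : Graph n) → ∑ (λ x → count (adj G x)) ≡ 2 * edgeCount G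
handshake G = begin
    ∑ (λ x → count (adj G x))
  ≡⟨ ∑-ext (λ x → trans (∑-ext (adj≡up+down G x)) (∑-+ (λ y → ind ((x <ᶠ y) ∧ adj G x y)) (λ y → ind ((y <ᶠ x) ∧ adj G y x)))) ⟩
    ∑ (λ x → up-degree G x + down-degree G x)
  ≡⟨ ∑-+ (up-degree G) (down-degree G) ⟩
    ∑ (up-degree G) + ∑ (down-degree G)
  ≡⟨ cong (∑ (up-degree G) +_) (∑-swap (λ x y → ind ((y <ᶠ x) ∧ adj G y x))) ⟩
    ∑ (up-degree G) + ∑ (up-degree G)
  ≡⟨ cong (_+_ (∑ (up-degree G))) (≡-sym (+-identityʳ _)) ⟩
    2 * ∑ (up-degree G)
  ≡⟨ cong (2 *_) (≡-sym (edgeCount≡∑up G)) ⟩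
    2 * edgeCount G ∎
  where open ≡-Reasoning

adj⇒≢ : ∀ {n} (G : Graph n) {u v} → T (adj G u v) → u ≢ v
adj⇒≢ G {u} a refl rewrite irrefl G u = a

adj-sym : ∀ {n} (G : Graph n) {u v} → T (adj G u v) → T (adj G v u)
adj-sym G {u} {v} a rewrite sym G u v = a

degree<n : ∀ {n} (G : Graph n) v → suc (count (adj G v)) ≤ n
degree<n G v = count+1≤ (adj G v) v (irrefl G v)

dominating : ∀ {n} (G : Graph n) v → n ≤ suc (count (adj G v)) → ∀ y → y ≢ v → T (adj G v y)
dominating G v le y yv = count-full (adj G v) v (irrefl G v) le y (≢-sym yv)

fin2-alternate : ∀ (a b c : Fin 2) → a ≢ b → b ≢ c → a ≡ c
fin2-alternate zero zero _ h _ = ⊥-elim (h refl)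
fin2-alternate zero (suc zero) zero _ _ = refl
fin2-alternate zero (suc zero) (suc zero) _ h = ⊥-elim (h refl)
fin2-alternate (suc zero) (suc zero) _ h _ = ⊥-elim (h refl)
fin2-alternate (suc zero) zero (suc zero) _ _ = refl
fin2-alternate (suc zero) zero zero _ h = ⊥-elim (h refl)

Proper3 : ∀ {n} → Graph n → (Fin n → Fin 3) → Set
Proper3 G c = ∀ u v → T (adj G u v) → c u ≢ c v

proper3⇒colourable : ∀ {n} {G : Graph n} (c : Fin n → Fin 3) → Proper3 G c → Colourable G allV 3
proper3⇒colourable c p = (λ v _ → c v) , (λ u v _ _ a → p u v a)

-- A colouring of G - u (resp. G - x - y) presented as a total function on
-- the vertices, proper on the edges avoiding the deleted vertices.
ColouringMinus1 : ∀ {n} → Graph n → Fin n → ℕ → Set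
ColouringMinus1 {n} G u k = Σ (Fin n → Fin k) λ f → ∀ a b → a ≢ u → b ≢ u → T (adj G a b) → f a ≢ f b

ColouringMinus2 : ∀ {n} → Graph n → Fin n → Fin n → ℕ → Set
ColouringMinus2 {n} G x y k =
  Σ (Fin n → Fin k) λ f → ∀ a b → a ≢ x → a ≢ y → b ≢ x → b ≢ y → T (adj G a b) → f a ≢ f b

totalise1 : ∀ {n k} {G : Graph n} {u} → Colourable G (minus1 u) (suc k) → ColouringMinus1 G u (suc k)
totalise1 {n} {k} {G} {u} (c , p) = f , proper
  where
  f : Fin n → Fin (suc k)
  f a with a ≟ u
  ... | yes _ = zero
  ... | no au = c a au
  proper : ∀ a b → a ≢ u → b ≢ u → T (adj G a b) → f a ≢ f b
  proper a b au bu ab with a ≟ u | b ≟ u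
  ... | yes e | _ = ⊥-elim (au e)
  ... | no _ | yes e = ⊥-elim (bu e)
  ... | no au' | no bu' = p a b au' bu' ab

totalise2 : ∀ {n k} {G : Graph n} {x y} → Colourable G (minus2 x y) (suc k) → ColouringMinus2 G x y (suc k)
totalise2 {n} {k} {G} {x} {y} (c , p) = f , proper
  where
  f : Fin n → Fin (suc k)
  f a with a ≟ x | a ≟ y
  ... | no ax | no ay = c a (ax , ay)
  ... | _ | _ = zero
  proper : ∀ a b → a ≢ x → a ≢ y → b ≢ x → b ≢ y → T (adj G a b) → f a ≢ f b
  proper a b ax ay bx by ab with a ≟ x | a ≟ y | b ≟ x | b ≟ y
  ... | no ax' | no ay' | no bx' | no by' = p a b (ax' , ay') (bx' , by') ab
  ... | yes e | _ | _ | _ = ⊥-elim (ax e)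
  ... | no _ | yes e | _ | _ = ⊥-elim (ay e)
  ... | no _ | no _ | yes e | _ = ⊥-elim (bx e)
  ... | no _ | no _ | no _ | yes e = ⊥-elim (by e)

swapMinus2 : ∀ {n} {G : Graph n} {x y k} → ColouringMinus2 G x y k → ColouringMinus2 G y x k
swapMinus2 (f , p) = f , λ a b ay ax by bx ab → p a b ax ay bx by ab

extendByFreeColour : ∀ {n} {G : Graph n} u (t : ColouringMinus1 G u 3) (k : Fin 3) →
  (∀ y → T (adj G u y) → proj₁ t y ≢ k) → Colourable G allV 3
extendByFreeColour {n} {G} u (f , pf) k free = proper3⇒colourable {G = G} g proper
  where
  g : Fin n → Fin 3
  g a with a ≟ u
  ... | yes _ = k
  ... | no _ = f a
  proper : Proper3 G g
  proper a b ab with a ≟ u | b ≟ u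
  ... | yes refl | yes refl = λ _ → adj⇒≢ G ab refl
  ... | yes refl | no _ = λ e → free b ab (≡-sym e)
  ... | no _ | yes refl = free a (adj-sym G ab)
  ... | no au | no bu = pf a b au bu ab

-- Basic properties of 4-critical graphs

module Critical4 {n} {G : Graph n} (cr : Critical 4 G) where

  not3colourable : ¬ Colourable G allV 3
  not3colourable = proj₂ (proj₁ cr) 3 (s≤s (s≤s (s≤s (s≤s z≤n))))

  colourMinus : ∀ v → ColouringMinus1 G v 3
  colourMinus v with proj₂ cr v
  ... | j , j<4 , ((c , p) , _) = totalise1 {G = G} (widen c , λ a b sa sb ab e → p a b sa sb ab (FP.inject≤-injective j≤3 j≤3 _ _ e))
    where
    j≤3 : j ≤ 3
    j≤3 = s≤s⁻¹ j<4
    widen : ((w : Fin n) → minus1 v w → Fin j) → (w : Fin n) → minus1 v w → Fin 3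
    widen c w s = inject≤ (c w s) j≤3

  χ≡4 : ∀ {k} → HasChromatic G allV k → k ≡ 4
  χ≡4 {k} h with <-cmp k 4
  ... | tri< lt _ _ = ⊥-elim (proj₂ (proj₁ cr) k lt (proj₁ h))
  ... | tri≈ _ e _ = e
  ... | tri> _ _ gt = ⊥-elim (proj₂ h 4 gt (proj₁ (proj₁ cr)))

  dcColouring : ∀ {x y} → DoubleCritical G x y → ColouringMinus2 G x y 2
  dcColouring (_ , k , h , h₂) with χ≡4 h
  ... | refl = totalise2 {G = G} (proj₁ h₂)

  -- minimum degree ≥ 3: in a 3-colouring of G - u every colour occurs on a
  -- neighbour of u (a free colour could be given to u), so u has 3 neighbours
  minDegree : ∀ u → 3 ≤ count (adj G u)
  minDegree u = count-≥ (adj G u) witness witness-injective (λ k → proj₁ (proj₂ (occurs k)))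
    where
    f : Fin n → Fin 3
    f = proj₁ (colourMinus u)
    occurs : ∀ k → ∃ λ y → T (adj G u y) × f y ≡ k
    occurs k with FP.any? (λ y → T? (adj G u y) ×-dec (f y ≟ k))
    ... | yes p = p
    ... | no none = ⊥-elim (not3colourable (extendByFreeColour {G = G} u (colourMinus u) k (λ y a e → none (y , a , e))))
    witness : Fin 3 → Fin n
    witness k = proj₁ (occurs k)
    witness-injective : ∀ i j → witness i ≡ witness j → i ≡ j
    witness-injective i j e = trans (≡-sym (proj₂ (proj₂ (occurs i)))) (trans (cong f e) (proj₂ (proj₂ (occurs j))))

-- With 2-colourings κ₁ of G - x - y and κ₂ of G - u - w, colour
-- x ↦ 2, y ↦ 1, u ↦ 0, w ↦ 1, and any other vertex z by
--   0 if κ₁ z = κ₁ u,   else 2 if κ₂ z = κ₂ x,   else 1.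

c0 c1 c2 : Fin 3
c0 = zero
c1 = suc zero
c2 = suc (suc zero)

-- the colour of an ordinary vertex with κ₁-colour p and κ₂-colour q
-- (pu = κ₁ u, qx = κ₂ x)
mix : Fin 2 → Fin 2 → Fin 2 → Fin 2 → Fin 3
mix p pu q qx with p ≟ pu | q ≟ qx
... | yes _ | _ = c0
... | no _ | yes _ = c2
... | no _ | no _ = c1

mix-distinct : ∀ p p' pu q q' qx → p ≢ p' → q ≢ q' → mix p pu q qx ≢ mix p' pu q' qx
mix-distinct p p' pu q q' qx h1 h2 with p ≟ pu | q ≟ qx | p' ≟ pu | q' ≟ qx
... | yes e | _ | yes e' | _ = ⊥-elim (h1 (trans e (≡-sym e')))
... | yes _ | _ | no _ | yes _ = λ ()
... | yes _ | _ | no _ | no _ = λ ()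
... | no _ | yes _ | yes _ | _ = λ ()
... | no _ | no _ | yes _ | _ = λ ()
... | no a | _ | no b | _ = ⊥-elim (h1 (fin2-alternate p pu p' a (≢-sym b)))

-- neighbours of x avoid colour 2
mix≢c2 : ∀ p pu q qx → q ≢ qx → mix p pu q qx ≢ c2
mix≢c2 p pu q qx h with p ≟ pu | q ≟ qx
... | yes _ | _ = λ ()
... | no _ | yes e = ⊥-elim (h e)
... | no _ | no _ = λ ()

-- neighbours of y avoid colour 1 (as κ₂ y ≠ κ₂ x)
mix≢c1-viaκ₂ : ∀ p pu q qx qy → q ≢ qy → qy ≢ qx → mix p pu q qx ≢ c1
mix≢c1-viaκ₂ p pu q qx qy h1 h2 with p ≟ pu | q ≟ qx
... | yes _ | _ = λ ()
... | no _ | yes _ = λ ()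
... | no _ | no ne = ⊥-elim (ne (fin2-alternate q qy qx h1 h2))

-- neighbours of u avoid colour 0
mix≢c0 : ∀ p pu q qx → p ≢ pu → mix p pu q qx ≢ c0
mix≢c0 p pu q qx h with p ≟ pu | q ≟ qx
... | yes e | _ = ⊥-elim (h e)
... | no _ | yes _ = λ ()
... | no _ | no _ = λ ()

-- neighbours of w avoid colour 1 (as κ₁ w ≠ κ₁ u)
mix≢c1-viaκ₁ : ∀ p pu pw q qx → p ≢ pw → pw ≢ pu → mix p pu q qx ≢ c1
mix≢c1-viaκ₁ p pu pw q qx h1 h2 with p ≟ pu | q ≟ qx
... | yes _ | _ = λ ()
... | no ne | _ = ⊥-elim (ne (fin2-alternate p pw pu h1 h2))

module DisjointDoubleCritical {n} (G : Graph n) (x y u w : Fin n)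
  (xu : x ≢ u) (xw : x ≢ w) (yu : y ≢ u) (yw : y ≢ w)
  (axy : T (adj G x y)) (auw : T (adj G u w))
  (t₁ : ColouringMinus2 G x y 2) (t₂ : ColouringMinus2 G u w 2)
  (y≁w : ¬ T (adj G y w)) where

  κ₁ κ₂ : Fin n → Fin 2
  κ₁ = proj₁ t₁
  κ₂ = proj₁ t₂

  κ₁-proper : ∀ a b → a ≢ x → a ≢ y → b ≢ x → b ≢ y → T (adj G a b) → κ₁ a ≢ κ₁ b
  κ₁-proper = proj₂ t₁

  κ₂-proper : ∀ a b → a ≢ u → a ≢ w → b ≢ u → b ≢ w → T (adj G a b) → κ₂ a ≢ κ₂ b
  κ₂-proper = proj₂ t₂

  colour : Fin n → Fin 3
  colour z with z ≟ x | z ≟ y | z ≟ u | z ≟ w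
  ... | yes _ | _ | _ | _ = c2
  ... | no _ | yes _ | _ | _ = c1
  ... | no _ | no _ | yes _ | _ = c0
  ... | no _ | no _ | no _ | yes _ = c1
  ... | no _ | no _ | no _ | no _ = mix (κ₁ z) (κ₁ u) (κ₂ z) (κ₂ x)

  nbx : ∀ b → b ≢ u → b ≢ w → T (adj G x b) → mix (κ₁ b) (κ₁ u) (κ₂ b) (κ₂ x) ≢ c2
  nbx b bu bw ab = mix≢c2 (κ₁ b) (κ₁ u) (κ₂ b) (κ₂ x) (κ₂-proper b x bu bw xu xw (adj-sym G ab))

  nby : ∀ b → b ≢ u → b ≢ w → T (adj G y b) → mix (κ₁ b) (κ₁ u) (κ₂ b) (κ₂ x) ≢ c1
  nby b bu bw ab = mix≢c1-viaκ₂ (κ₁ b) (κ₁ u) (κ₂ b) (κ₂ x) (κ₂ y)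
    (κ₂-proper b y bu bw yu yw (adj-sym G ab)) (κ₂-proper y x yu yw xu xw (adj-sym G axy))

  nbu : ∀ b → b ≢ x → b ≢ y → T (adj G u b) → mix (κ₁ b) (κ₁ u) (κ₂ b) (κ₂ x) ≢ c0
  nbu b bx by ab = mix≢c0 (κ₁ b) (κ₁ u) (κ₂ b) (κ₂ x) (κ₁-proper b u bx by (≢-sym xu) (≢-sym yu) (adj-sym G ab))

  nbw : ∀ b → b ≢ x → b ≢ y → T (adj G w b) → mix (κ₁ b) (κ₁ u) (κ₂ b) (κ₂ x) ≢ c1
  nbw b bx by ab = mix≢c1-viaκ₁ (κ₁ b) (κ₁ u) (κ₁ w) (κ₂ b) (κ₂ x)
    (κ₁-proper b w bx by (≢-sym xw) (≢-sym yw) (adj-sym G ab))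
    (κ₁-proper w u (≢-sym xw) (≢-sym yw) (≢-sym xu) (≢-sym yu) (adj-sym G auw))

  proper : Proper3 G colour
  proper a b ab with a ≟ x | a ≟ y | a ≟ u | a ≟ w | b ≟ x | b ≟ y | b ≟ u | b ≟ w
  ... | yes refl | _ | _ | _ | yes refl | _ | _ | _ = ⊥-elim (adj⇒≢ G ab refl)
  ... | yes refl | _ | _ | _ | no _ | yes refl | _ | _ = λ ()
  ... | yes refl | _ | _ | _ | no _ | no _ | yes refl | _ = λ ()
  ... | yes refl | _ | _ | _ | no _ | no _ | no _ | yes refl = λ ()
  ... | yes refl | _ | _ | _ | no _ | no _ | no bu | no bw = ≢-sym (nbx b bu bw ab)
  ... | no _ | yes refl | _ | _ | yes refl | _ | _ | _ = λ ()
  ... | no _ | yes refl | _ | _ | no _ | yes refl | _ | _ = ⊥-elim (adj⇒≢ G ab refl)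
  ... | no _ | yes refl | _ | _ | no _ | no _ | yes refl | _ = λ ()
  ... | no _ | yes refl | _ | _ | no _ | no _ | no _ | yes refl = ⊥-elim (y≁w ab)
  ... | no _ | yes refl | _ | _ | no _ | no _ | no bu | no bw = ≢-sym (nby b bu bw ab)
  ... | no _ | no _ | yes refl | _ | yes refl | _ | _ | _ = λ ()
  ... | no _ | no _ | yes refl | _ | no _ | yes refl | _ | _ = λ ()
  ... | no _ | no _ | yes refl | _ | no _ | no _ | yes refl | _ = ⊥-elim (adj⇒≢ G ab refl)
  ... | no _ | no _ | yes refl | _ | no _ | no _ | no _ | yes refl = λ ()
  ... | no _ | no _ | yes refl | _ | no bx | no by | no _ | no _ = ≢-sym (nbu b bx by ab)
  ... | no _ | no _ | no _ | yes refl | yes refl | _ | _ | _ = λ ()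
  ... | no _ | no _ | no _ | yes refl | no _ | yes refl | _ | _ = ⊥-elim (y≁w (adj-sym G ab))
  ... | no _ | no _ | no _ | yes refl | no _ | no _ | yes refl | _ = λ ()
  ... | no _ | no _ | no _ | yes refl | no _ | no _ | no _ | yes refl = ⊥-elim (adj⇒≢ G ab refl)
  ... | no _ | no _ | no _ | yes refl | no bx | no by | no _ | no _ = ≢-sym (nbw b bx by ab)
  ... | no _ | no _ | no au | no aw | yes refl | _ | _ | _ = nbx a au aw (adj-sym G ab)
  ... | no _ | no _ | no au | no aw | no _ | yes refl | _ | _ = nby a au aw (adj-sym G ab)
  ... | no ax | no ay | no _ | no _ | no _ | no _ | yes refl | _ = nbu a ax ay (adj-sym G ab)
  ... | no ax | no ay | no _ | no _ | no _ | no _ | no _ | yes refl = nbw a ax ay (adj-sym G ab)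
  ... | no ax | no ay | no au | no aw | no bx | no by | no bu | no bw =
    mix-distinct (κ₁ a) (κ₁ b) (κ₁ u) (κ₂ a) (κ₂ b) (κ₂ x) (κ₁-proper a b ax ay bx by ab) (κ₂-proper a b au aw bu bw ab)

  threeColouring : Colourable G allV 3
  threeColouring = proper3⇒colourable {G = G} colour proper

-- Any two double-critical edges of a 4-critical non-complete graph meet

quad : ∀ {n} → Fin n → Fin n → Fin n → Fin n → Fin 4 → Fin n
quad a b c d zero = a
quad a b c d (suc zero) = b
quad a b c d (suc (suc zero)) = c
quad a b c d (suc (suc (suc zero))) = d

quad-injective : ∀ {n} {a b c d : Fin n} → a ≢ b → a ≢ c → a ≢ d → b ≢ c → b ≢ d → c ≢ d →
  ∀ i j → quad a b c d i ≡ quad a b c d j → i ≡ j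
quad-injective ab ac ad bc bd cd zero zero e = refl
quad-injective ab ac ad bc bd cd zero (suc zero) e = ⊥-elim (ab e)
quad-injective ab ac ad bc bd cd zero (suc (suc zero)) e = ⊥-elim (ac e)
quad-injective ab ac ad bc bd cd zero (suc (suc (suc zero))) e = ⊥-elim (ad e)
quad-injective ab ac ad bc bd cd (suc zero) zero e = ⊥-elim (ab (≡-sym e))
quad-injective ab ac ad bc bd cd (suc zero) (suc zero) e = refl
quad-injective ab ac ad bc bd cd (suc zero) (suc (suc zero)) e = ⊥-elim (bc e)
quad-injective ab ac ad bc bd cd (suc zero) (suc (suc (suc zero))) e = ⊥-elim (bd e)
quad-injective ab ac ad bc bd cd (suc (suc zero)) zero e = ⊥-elim (ac (≡-sym e))
quad-injective ab ac ad bc bd cd (suc (suc zero)) (suc zero) e = ⊥-elim (bc (≡-sym e))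
quad-injective ab ac ad bc bd cd (suc (suc zero)) (suc (suc zero)) e = refl
quad-injective ab ac ad bc bd cd (suc (suc zero)) (suc (suc (suc zero))) e = ⊥-elim (cd e)
quad-injective ab ac ad bc bd cd (suc (suc (suc zero))) zero e = ⊥-elim (ad (≡-sym e))
quad-injective ab ac ad bc bd cd (suc (suc (suc zero))) (suc zero) e = ⊥-elim (bd (≡-sym e))
quad-injective ab ac ad bc bd cd (suc (suc (suc zero))) (suc (suc zero)) e = ⊥-elim (cd (≡-sym e))
quad-injective ab ac ad bc bd cd (suc (suc (suc zero))) (suc (suc (suc zero))) e = refl

IsK4 : ∀ {n} → Graph n → (Fin 4 → Fin n) → Set
IsK4 G k = ∀ i j → i ≢ j → T (adj G (k i) (k j))

quad-K4 : ∀ {n} (G : Graph n) {a b c d : Fin n} → T (adj G a b) → T (adj G a c) → T (adj G a d) →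
  T (adj G b c) → T (adj G b d) → T (adj G c d) → IsK4 G (quad a b c d)
quad-K4 G ab ac ad bc bd cd = k4
  where
  k4 : IsK4 G _
  k4 zero zero ne = ⊥-elim (ne refl)
  k4 zero (suc zero) _ = ab
  k4 zero (suc (suc zero)) _ = ac
  k4 zero (suc (suc (suc zero))) _ = ad
  k4 (suc zero) zero _ = adj-sym G ab
  k4 (suc zero) (suc zero) ne = ⊥-elim (ne refl)
  k4 (suc zero) (suc (suc zero)) _ = bc
  k4 (suc zero) (suc (suc (suc zero))) _ = bd
  k4 (suc (suc zero)) zero _ = adj-sym G ac
  k4 (suc (suc zero)) (suc zero) _ = adj-sym G bc
  k4 (suc (suc zero)) (suc (suc zero)) ne = ⊥-elim (ne refl)
  k4 (suc (suc zero)) (suc (suc (suc zero))) _ = cd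
  k4 (suc (suc (suc zero))) zero _ = adj-sym G ad
  k4 (suc (suc (suc zero))) (suc zero) _ = adj-sym G bd
  k4 (suc (suc (suc zero))) (suc (suc zero)) _ = adj-sym G cd
  k4 (suc (suc (suc zero))) (suc (suc (suc zero))) ne = ⊥-elim (ne refl)

-- A 4-critical graph containing a K₄ is that K₄: a vertex z outside it
-- would leave a K₄ inside the 3-colourable graph G - z.
K4-critical-complete : ∀ {n} {G : Graph n} → Critical 4 G → ∀ k → IsK4 G k → ¬ NonComplete G
K4-critical-complete {n} {G} cr k isK4 (a , b , ab , a≁b) with covered a | covered b
  where
  open Critical4 {G = G} cr
  covered : ∀ z → ∃ λ i → z ≡ k i
  covered z with FP.any? (λ i → z ≟ k i)
  ... | yes p = p
  ... | no outside = ⊥-elim (4≰3 (FP.injective⇒≤ {f = λ i → proj₁ (colourMinus z) (k i)} inj))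
    where
    4≰3 : ¬ (4 ≤ 3)
    4≰3 (s≤s (s≤s (s≤s ())))
    inj : ∀ {i j} → proj₁ (colourMinus z) (k i) ≡ proj₁ (colourMinus z) (k j) → i ≡ j
    inj {i} {j} e with i ≟ j
    ... | yes p = p
    ... | no ne = ⊥-elim (proj₂ (colourMinus z) (k i) (k j) (λ q → outside (i , ≡-sym q)) (λ q → outside (j , ≡-sym q)) (isK4 i j ne) e)
... | i , refl | j , refl with i ≟ j
...   | yes refl = ab refl
...   | no ne = a≁b (isK4 i j ne)

module Meeting {n} {G : Graph n} (cr : Critical 4 G) (nc : NonComplete G) where
  open Critical4 {G = G} cr

  disjointDC-absurd : ∀ {x y u w} → DoubleCritical G x y → DoubleCritical G u w → x ≢ u → x ≢ w → y ≢ u → y ≢ w → ⊥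
  disjointDC-absurd {x} {y} {u} {w} d₁ d₂ xu xw yu yw =
    byAdjacency (T? (adj G x u)) (T? (adj G x w)) (T? (adj G y u)) (T? (adj G y w))
    where
    axy : T (adj G x y)
    axy = proj₁ d₁
    auw : T (adj G u w)
    auw = proj₁ d₂
    t₁ : ColouringMinus2 G x y 2
    t₁ = dcColouring d₁
    t₂ : ColouringMinus2 G u w 2
    t₂ = dcColouring d₂
    -- a non-adjacent cross pair gives a 3-colouring, otherwise x y u w is a K₄
    byAdjacency : Dec (T (adj G x u)) → Dec (T (adj G x w)) → Dec (T (adj G y u)) → Dec (T (adj G y w)) → ⊥
    byAdjacency _ _ _ (no y≁w) = not3colourable (DisjointDoubleCritical.threeColouring G x y u w
      xu xw yu yw axy auw t₁ t₂ y≁w)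
    byAdjacency _ (no x≁w) _ _ = not3colourable (DisjointDoubleCritical.threeColouring G y x u w
      yu yw xu xw (adj-sym G axy) auw (swapMinus2 {G = G} t₁) t₂ x≁w)
    byAdjacency _ _ (no y≁u) _ = not3colourable (DisjointDoubleCritical.threeColouring G x y w u
      xw xu yw yu axy (adj-sym G auw) t₁ (swapMinus2 {G = G} t₂) y≁u)
    byAdjacency (no x≁u) _ _ _ = not3colourable (DisjointDoubleCritical.threeColouring G y x w u
      yw yu xw xu (adj-sym G axy) (adj-sym G auw) (swapMinus2 {G = G} t₁) (swapMinus2 {G = G} t₂) x≁u)
    byAdjacency (yes axu) (yes axw) (yes ayu) (yes ayw) =
      K4-critical-complete {G = G} cr (quad x y u w) (quad-K4 G axy axu axw ayu ayw auw) nc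

-- Pairwise intersecting families of edges: a star, or at most 3 edges

Ordered : ∀ {n} → Fin n × Fin n → Set
Ordered (x , y) = toℕ x < toℕ y

Mem : ∀ {n} → Fin n → Fin n × Fin n → Set
Mem z (x , y) = z ≡ x ⊎ z ≡ y

Mem? : ∀ {n} (z : Fin n) e → Dec (Mem z e)
Mem? z (x , y) with z ≟ x | z ≟ y
... | yes p | _ = yes (inj₁ p)
... | no _ | yes q = yes (inj₂ q)
... | no p | no q = no λ { (inj₁ e) → p e ; (inj₂ e) → q e }

Meet : ∀ {n} → Fin n × Fin n → Fin n × Fin n → Set
Meet e f = ∃ λ z → Mem z e × Mem z f

Ordered⇒≢ : ∀ {n} {x y : Fin n} → toℕ x < toℕ y → x ≢ y
Ordered⇒≢ lt refl = <-irrefl refl lt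

two-members : ∀ {n} {s t : Fin n} e → s ≢ t → Mem s e → Mem t e →
  (s ≡ proj₁ e × t ≡ proj₂ e) ⊎ (s ≡ proj₂ e × t ≡ proj₁ e)
two-members e st (inj₁ refl) (inj₁ refl) = ⊥-elim (st refl)
two-members e st (inj₁ p) (inj₂ q) = inj₁ (p , q)
two-members e st (inj₂ p) (inj₁ q) = inj₂ (p , q)
two-members e st (inj₂ refl) (inj₂ refl) = ⊥-elim (st refl)

edge-determined : ∀ {n} {s t : Fin n} e e' → Ordered e → Ordered e' → s ≢ t →
  Mem s e → Mem t e → Mem s e' → Mem t e' → e ≡ e'
edge-determined (x , y) (x' , y') o o' st a b c d with two-members (x , y) st a b | two-members (x' , y') st c d
... | inj₁ (refl , refl) | inj₁ (refl , refl) = refl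
... | inj₂ (refl , refl) | inj₂ (refl , refl) = refl
... | inj₁ (refl , refl) | inj₂ (refl , refl) = ⊥-elim (<-asym o o')
... | inj₂ (refl , refl) | inj₁ (refl , refl) = ⊥-elim (<-asym o o')

other-member-unique : ∀ {n} {z z' a : Fin n} e → Mem z e → Mem z' e → Mem a e → z ≢ a → z' ≢ a → z ≡ z'
other-member-unique e (inj₁ refl) (inj₁ refl) _ _ _ = refl
other-member-unique e (inj₂ refl) (inj₂ refl) _ _ _ = refl
other-member-unique e (inj₁ refl) (inj₂ refl) (inj₁ refl) p q = ⊥-elim (p refl)
other-member-unique e (inj₁ refl) (inj₂ refl) (inj₂ refl) p q = ⊥-elim (q refl)
other-member-unique e (inj₂ refl) (inj₁ refl) (inj₁ refl) p q = ⊥-elim (q refl)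
other-member-unique e (inj₂ refl) (inj₁ refl) (inj₂ refl) p q = ⊥-elim (p refl)

-- Two edges through p avoiding q, both meeting an edge f through q avoiding p,
-- coincide: both consist of p and the other vertex of f.
pinned : ∀ {n} {p q : Fin n} e e' f → Ordered e → Ordered e' →
  Mem p e → Mem p e' → ¬ Mem q e → ¬ Mem q e' → Mem q f → ¬ Mem p f → Meet e f → Meet e' f → e ≡ e'
pinned {p = p} {q} e e' f o o' pe pe' q∉e q∉e' qf p∉f (z , ze , zf) (z' , z'e' , z'f) =
  edge-determined e e' o o' p≢z pe ze pe' (subst (λ r → Mem r e') (≡-sym z≡z') z'e')
  where
  z≡z' : z ≡ z'
  z≡z' = other-member-unique f zf z'f qf (λ e → q∉e (subst (λ r → Mem r _) e ze)) (λ e → q∉e' (subst (λ r → Mem r _) e z'e'))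
  p≢z : p ≢ z
  p≢z e = p∉f (subst (λ r → Mem r f) (≡-sym e) zf)

Star : ∀ {n d} → (Fin d → Fin n × Fin n) → Set
Star E = ∃ λ v → ∀ i → Mem v (E i)

-- If e₀ = (a , b), some edge e₁ avoids a and some e₂ avoids b, then every
-- edge is e₀ (through a and b), e₁ (through b only) or e₂ (through a only).
module NonStar {n d} (E : Fin d → Fin n × Fin n) (ordered : ∀ i → Ordered (E i))
  (E-inj : ∀ i j → E i ≡ E j → i ≡ j) (meet : ∀ i j → Meet (E i) (E j))
  (i₀ i₁ i₂ : Fin d) (a∉e₁ : ¬ Mem (proj₁ (E i₀)) (E i₁)) (b∉e₂ : ¬ Mem (proj₂ (E i₀)) (E i₂)) where

  a b : Fin n
  a = proj₁ (E i₀)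
  b = proj₂ (E i₀)

  a-or-b : ∀ j → Mem a (E j) ⊎ Mem b (E j)
  a-or-b j with meet j i₀
  ... | z , zj , inj₁ refl = inj₁ zj
  ... | z , zj , inj₂ refl = inj₂ zj

  only-b : ∀ j → ¬ Mem a (E j) → Mem b (E j)
  only-b j a∉ with a-or-b j
  ... | inj₁ p = ⊥-elim (a∉ p)
  ... | inj₂ p = p

  only-a : ∀ j → ¬ Mem b (E j) → Mem a (E j)
  only-a j b∉ with a-or-b j
  ... | inj₁ p = p
  ... | inj₂ p = ⊥-elim (b∉ p)

  representative : Fin 3 → Fin d
  representative zero = i₁
  representative (suc zero) = i₂
  representative (suc (suc zero)) = i₀

  classify : ∀ j → ∃ λ c → E j ≡ E (representative c)
  classify j with Mem? a (E j) | Mem? b (E j)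
  ... | no a∉ | _ = c0 , pinned (E j) (E i₁) (E i₂) (ordered j) (ordered i₁) (only-b j a∉) (only-b i₁ a∉e₁)
                          a∉ a∉e₁ (only-a i₂ b∉e₂) b∉e₂ (meet j i₂) (meet i₁ i₂)
  ... | yes a∈ | no b∉ = c1 , pinned (E j) (E i₂) (E i₁) (ordered j) (ordered i₂) a∈ (only-a i₂ b∉e₂)
                          b∉ b∉e₂ (only-b i₁ a∉e₁) a∉e₁ (meet j i₁) (meet i₂ i₁)
  ... | yes a∈ | yes b∈ = c2 , edge-determined (E j) (E i₀) (ordered j) (ordered i₀) (Ordered⇒≢ (ordered i₀))
                          a∈ b∈ (inj₁ refl) (inj₂ refl)

  atMost3 : d ≤ 3
  atMost3 = FP.injective⇒≤ {f = λ j → proj₁ (classify j)} injective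
    where
    injective : ∀ {i j} → proj₁ (classify i) ≡ proj₁ (classify j) → i ≡ j
    injective {i} {j} e = E-inj i j (trans (proj₂ (classify i)) (trans (cong (E ∘ representative) e) (≡-sym (proj₂ (classify j)))))

starOrSmall : ∀ {n d} (E : Fin d → Fin n × Fin n) → (∀ i → Ordered (E i)) → (∀ i j → E i ≡ E j → i ≡ j) →
  (∀ i j → Meet (E i) (E j)) → Star E ⊎ d ≤ 3
starOrSmall {d = zero} E ordered E-inj meet = inj₂ z≤n
starOrSmall {d = suc d} E ordered E-inj meet
  with FP.all? (λ i → Mem? (proj₁ (E zero)) (E i)) | FP.all? (λ i → Mem? (proj₂ (E zero)) (E i))
... | yes all-a | _ = inj₁ (_ , all-a)
... | no _ | yes all-b = inj₁ (_ , all-b)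
... | no not-all-a | no not-all-b = inj₂ (NonStar.atMost3 E ordered E-inj meet zero
        (proj₁ avoid-a) (proj₁ avoid-b) (proj₂ avoid-a) (proj₂ avoid-b))
  where
  avoid-a : ∃ λ i → ¬ Mem (proj₁ (E zero)) (E i)
  avoid-a = FP.¬∀⟶∃¬ _ _ (λ i → Mem? (proj₁ (E zero)) (E i)) not-all-a
  avoid-b : ∃ λ i → ¬ Mem (proj₂ (E zero)) (E i)
  avoid-b = FP.¬∀⟶∃¬ _ _ (λ i → Mem? (proj₂ (E zero)) (E i)) not-all-b

-- Arithmetic of the degree count around a vertex v of degree D, where H is
-- the sum of the other degrees (so D + H = 2m, D < n and H ≥ 3(n - 1)).

private
  4D≡D+3D : ∀ D → D * 4 ≡ D + D * 3
  4D≡D+3D = solve-∀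
  2[2d]≡4d : ∀ d → 2 * (2 * d) ≡ d * 4
  2[2d]≡4d = solve-∀
  3[D+1]≡3D+3 : ∀ D → suc D * 3 ≡ D * 3 + 3
  3[D+1]≡3D+3 = solve-∀

others≥3D : ∀ D H n → suc D ≤ n → n * 3 ≤ H + 3 → D * 3 ≤ H
others≥3D D H n D<n hb =
  +-cancelʳ-≤ 3 (D * 3) H (subst (_≤ H + 3) (3[D+1]≡3D+3 D) (≤-trans (*-monoˡ-≤ 3 D<n) hb))

star-bound : ∀ d D H n m → d ≤ D → suc D ≤ n → n * 3 ≤ H + 3 → D + H ≡ 2 * m → 2 * d ≤ m
star-bound d D H n m d≤D D<n hb sum = *-cancelˡ-≤ 2 (begin
    2 * (2 * d) ≡⟨ 2[2d]≡4d d ⟩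
    d * 4       ≤⟨ *-monoˡ-≤ 4 d≤D ⟩
    D * 4       ≡⟨ 4D≡D+3D D ⟩
    D + D * 3   ≤⟨ +-monoʳ-≤ D (others≥3D D H n D<n hb) ⟩
    D + H       ≡⟨ sum ⟩
    2 * m       ∎)
  where open ≤-Reasoning

star-bound-tight : ∀ d D H n m → d ≤ D → suc D ≤ n → n * 3 ≤ H + 3 → D + H ≡ 2 * m → 2 * d ≡ m →
  (D ≡ d) × (suc D ≡ n) × (H + 3 ≡ n * 3)
star-bound-tight d D H n m d≤D D<n hb sum tight = D≡d , D+1≡n , H≡3[n-1]
  where
  3D≤H : D * 3 ≤ H
  3D≤H = others≥3D D H n D<n hb
  D+H≡4d : D + H ≡ d * 4
  D+H≡4d = trans sum (trans (cong (2 *_) (≡-sym tight)) (2[2d]≡4d d))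
  D≡d : D ≡ d
  D≡d = ≤-antisym (*-cancelʳ-≤ D d 4 (begin
      D * 4     ≡⟨ 4D≡D+3D D ⟩
      D + D * 3 ≤⟨ +-monoʳ-≤ D 3D≤H ⟩
      D + H     ≡⟨ D+H≡4d ⟩
      d * 4     ∎)) d≤D
    where open ≤-Reasoning
  H≡3D : H ≡ D * 3
  H≡3D = +-cancelˡ-≡ D H (D * 3) (trans D+H≡4d (trans (cong (_* 4) (≡-sym D≡d)) (4D≡D+3D D)))
  D+1≡n : suc D ≡ n
  D+1≡n = ≤-antisym D<n (*-cancelʳ-≤ n (suc D) 3 (subst (n * 3 ≤_) (trans (cong (_+ 3) H≡3D) (≡-sym (3[D+1]≡3D+3 D))) hb))
  H≡3[n-1] : H + 3 ≡ n * 3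
  H≡3[n-1] = trans (cong (_+ 3) H≡3D) (trans (≡-sym (3[D+1]≡3D+3 D)) (cong (_* 3) D+1≡n))

star-bound-attained : ∀ d D H n m → d ≡ D → suc D ≡ n → H + 3 ≡ n * 3 → D + H ≡ 2 * m → 2 * d ≡ m
star-bound-attained d D H n m refl refl H≡ sum = *-cancelˡ-≡ (2 * d) m 2 (begin
    2 * (2 * d) ≡⟨ 2[2d]≡4d d ⟩
    d * 4       ≡⟨ 4D≡D+3D d ⟩
    d + d * 3   ≡⟨ cong (d +_) (≡-sym H≡3d) ⟩
    d + H       ≡⟨ sum ⟩
    2 * m       ∎)
  where
  open ≡-Reasoning
  H≡3d : H ≡ d * 3
  H≡3d = +-cancelʳ-≡ 3 H (d * 3) (trans H≡ (3[D+1]≡3D+3 d))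

-- with at most 3 double-critical edges, 2d ≤ 6 < 8 ≤ m since 2m ≥ 3n ≥ 15
small-family : ∀ d n m → d ≤ 3 → 5 ≤ n → n * 3 ≤ 2 * m → 2 * d < m
small-family d n m d≤3 5≤n 3n≤2m with 8 ≤? m
... | yes 8≤m = ≤-trans (s≤s (*-monoʳ-≤ 2 d≤3)) (≤-trans (n≤1+n 7) 8≤m)
... | no m<8 = ⊥-elim (<-irrefl refl (≤-trans (≤-trans (*-monoˡ-≤ 3 5≤n) 3n≤2m) (*-monoʳ-≤ 2 (s≤s⁻¹ (≰⇒> m<8)))))

Sub-≡ : ∀ {a p} {A : Set a} {P : A → Set p} {s t : Sub A P} → elt s ≡ elt t → s ≡ t
Sub-≡ {s = ⟨ x , _ ⟩} {⟨ .x , _ ⟩} refl = refl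

recover : ∀ {a p q} {A : Set a} {P : A → Set p} {Q : A → Set q} (s : Sub A P) →
  (∀ x → P x → Q x) → (∀ x → Dec (Q x)) → Q (elt s)
recover ⟨ x , p ⟩ f dec = recompute (dec x) (f x p)

enumeration-injective : ∀ {a p} {A : Set a} {P : A → Set p} {d} (g : Fin d ↔ Sub A P) →
  ∀ i j → elt (Inverse.to g i) ≡ elt (Inverse.to g j) → i ≡ j
enumeration-injective g i j e = trans (≡-sym (inverseʳ refl)) (trans (cong from (Sub-≡ e)) (inverseʳ refl))
  where open Inverse g

-- The family of double-critical edges and the inequality 2d ≤ m

Meet? : ∀ {n} (e f : Fin n × Fin n) → Dec (Meet e f)
Meet? e f = FP.any? (λ z → Mem? z e ×-dec Mem? z f)

module DoubleCriticalEdges {n} (G : Graph n) (cr : Critical 4 G) (nc : NonComplete G)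
  (d : ℕ) (g : HasSize (DCEdge G) d) where
  open Critical4 {G = G} cr
  open Meeting {G = G} cr nc
  open Inverse g using (to)

  E : Fin d → Fin n × Fin n
  E i = elt (to i)

  E-ordered : ∀ i → Ordered (E i)
  E-ordered i = recover (to i) (λ _ p → proj₁ p) (λ e → toℕ (proj₁ e) <? toℕ (proj₂ e))

  E-injective : ∀ i j → E i ≡ E j → i ≡ j
  E-injective = enumeration-injective g

  E-adj : ∀ i → T (adj G (proj₁ (E i)) (proj₂ (E i)))
  E-adj i = recover (to i) (λ _ p → proj₁ (proj₂ p)) (λ e → T? (adj G (proj₁ e) (proj₂ e)))

  dc-meet : ∀ {x y u w} → DoubleCritical G x y → DoubleCritical G u w → Meet (x , y) (u , w)
  dc-meet {x} {y} {u} {w} d₁ d₂ with x ≟ u | x ≟ w | y ≟ u | y ≟ w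
  ... | yes p | _ | _ | _ = x , inj₁ refl , inj₁ p
  ... | no _ | yes p | _ | _ = x , inj₁ refl , inj₂ p
  ... | no _ | no _ | yes p | _ = y , inj₂ refl , inj₁ p
  ... | no _ | no _ | no _ | yes p = y , inj₂ refl , inj₂ p
  ... | no xu | no xw | no yu | no yw = ⊥-elim (disjointDC-absurd d₁ d₂ xu xw yu yw)

  E-meet : ∀ i j → Meet (E i) (E j)
  E-meet i j with to i | to j
  ... | ⟨ e , p ⟩ | ⟨ f , q ⟩ = recompute (Meet? e f) (dc-meet (proj₂ p) (proj₂ q))

  deg : Fin n → ℕ
  deg x = count (adj G x)

  -- G is not K₄ (nor smaller), so n ≥ 5: a non-adjacent pair rules out n ≤ 4
  5≤n : 5 ≤ n
  5≤n with 5 ≤? n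
  ... | yes p = p
  ... | no n≤4 = ⊥-elim (a≁b (dominating G a (≤-trans (s≤s⁻¹ (≰⇒> n≤4)) (s≤s (minDegree a))) b (≢-sym a≢b)))
    where
    a b : Fin n
    a = proj₁ nc
    b = proj₁ (proj₂ nc)
    a≢b : a ≢ b
    a≢b = proj₁ (proj₂ (proj₂ nc))
    a≁b : ¬ T (adj G a b)
    a≁b = proj₂ (proj₂ (proj₂ nc))

  3n≤2m : n * 3 ≤ 2 * edgeCount G
  3n≤2m = subst₂ _≤_ (∑-const {n} 3) (handshake G) (∑-mono minDegree)

  module StarAt (v : Fin n) (star : ∀ i → Mem v (E i)) where

    other : Fin n × Fin n → Fin n
    other (x , y) with x ≟ v
    ... | yes _ = y
    ... | no _ = x

    other-mem : ∀ e → Mem (other e) e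
    other-mem (x , y) with x ≟ v
    ... | yes _ = inj₂ refl
    ... | no _ = inj₁ refl

    other≢v : ∀ e → Ordered e → other e ≢ v
    other≢v (x , y) o with x ≟ v
    ... | yes refl = ≢-sym (Ordered⇒≢ o)
    ... | no x≢v = x≢v

    other-adj : ∀ e → Mem v e → T (adj G (proj₁ e) (proj₂ e)) → T (adj G v (other e))
    other-adj (x , y) v∈ a with x ≟ v | v∈
    ... | yes refl | _ = a
    ... | no x≢v | inj₁ e = ⊥-elim (x≢v (≡-sym e))
    ... | no _ | inj₂ refl = adj-sym G a

    spoke : Fin d → Fin n
    spoke i = other (E i)

    spoke-injective : ∀ i j → spoke i ≡ spoke j → i ≡ j
    spoke-injective i j e = E-injective i j (edge-determined (E i) (E j) (E-ordered i) (E-ordered j)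
      (≢-sym (other≢v (E i) (E-ordered i))) (star i) (other-mem (E i)) (star j)
      (subst (λ q → Mem q (E j)) (≡-sym e) (other-mem (E j))))

    d≤deg : d ≤ deg v
    d≤deg = count-≥ (adj G v) spoke spoke-injective (λ i → other-adj (E i) (star i) (E-adj i))

    rest : Fin n → ℕ
    rest y = if δ v y then 0 else deg y

    deg+rest : deg v + ∑ rest ≡ 2 * edgeCount G
    deg+rest = trans (≡-sym (∑-split deg v)) (handshake G)

    rest+3 : ∑ (λ y → rest y + ind (δ v y) * 3) ≡ ∑ rest + 3
    rest+3 = trans (∑-+ rest (λ y → ind (δ v y) * 3)) (cong (∑ rest +_) (∑-δ* v 3))

    rest-bound : n * 3 ≤ ∑ rest + 3
    rest-bound = subst₂ _≤_ (∑-const {n} 3) rest+3 (∑-mono pointwise)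
      where
      pointwise : ∀ y → 3 ≤ rest y + ind (δ v y) * 3
      pointwise y with v ≟ y
      ... | yes _ = ≤-refl
      ... | no _ = subst (3 ≤_) (≡-sym (+-identityʳ (deg y))) (minDegree y)

  starOrSmall-DC : Star E ⊎ d ≤ 3
  starOrSmall-DC = starOrSmall E E-ordered E-injective E-meet

  inequality : 2 * d ≤ edgeCount G
  inequality with starOrSmall-DC
  ... | inj₂ d≤3 = <⇒≤ (small-family d n (edgeCount G) d≤3 5≤n 3n≤2m)
  ... | inj₁ (v , star) = star-bound d (deg v) (∑ rest) n (edgeCount G) d≤deg (degree<n G v) rest-bound deg+rest
    where open StarAt v star

flip : Fin 2 → Fin 2
flip zero = suc zero
flip (suc zero) = zero

flip≢ : ∀ b → flip b ≢ b
flip≢ zero ()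
flip≢ (suc zero) ()

emb : Fin 2 → Fin 3
emb = inject₁

emb≢c2 : ∀ b → emb b ≢ c2
emb≢c2 b e = FP.fromℕ≢inject₁ (≡-sym e)

fin3-two-values : ∀ (a b c k : Fin 3) → a ≢ k → b ≢ k → c ≢ k → a ≢ b → b ≢ c → a ≡ c
fin3-two-values a b c k ak bk ck ab bc with a ≟ c
... | yes ac = ac
... | no ac = ⊥-elim (4≰3 (FP.injective⇒≤ {f = quad a b c k} (λ {i} {j} → quad-injective ab ac ak bc bk ck i j)))
  where
  4≰3 : ¬ (4 ≤ 3)
  4≰3 (s≤s (s≤s (s≤s ())))

[2+k]%2≡k%2 : ∀ k → (2 + k) % 2 ≡ k % 2
[2+k]%2≡k%2 k = trans (cong (_% 2) (+-comm 2 k)) (DM.[m+n]%n≡m%n k 2)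

%2≢1⇒%2≡0 : ∀ k → k % 2 ≢ 1 → k % 2 ≡ 0
%2≢1⇒%2≡0 k ne with k % 2 | DM.m%n<n k 2
... | zero | _ = refl
... | suc zero | _ = ⊥-elim (ne refl)
... | suc (suc _) | s≤s (s≤s ())

period2 : ∀ {a} {A : Set a} (c : ℕ → A) N → (∀ k → 2 + k ≤ N → c (2 + k) ≡ c k) → ∀ k → k ≤ N → c k ≡ c (k % 2)
period2 c N step zero _ = refl
period2 c N step (suc zero) _ = refl
period2 c N step (suc (suc k)) le =
  trans (step k le) (trans (period2 c N step k (≤-trans (n≤1+n k) (≤-trans (n≤1+n (suc k)) le))) (cong c (≡-sym ([2+k]%2≡k%2 k))))

least : ∀ {P : ℕ → Set} → Decidable P → ∀ N → (∃ λ k → k < N × P k) → ∃ λ j → P j × (∀ k → k < j → ¬ P k)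
least P? zero (k , () , _)
least {P} P? (suc N) (k , k<1+N , pk) with FP.any? {n = N} (λ (i : Fin N) → P? (toℕ i))
... | yes (i , pi) = least P? N (toℕ i , FP.toℕ<n i , pi)
... | no none-below = N , subst P (≤-antisym (s≤s⁻¹ k<1+N) (≮⇒≥ (λ k<N → none-below (below k<N pk)))) pk ,
                           λ j j<N pj → none-below (below j<N pj)
  where
  below : ∀ {j} → j < N → P j → ∃ λ (i : Fin N) → P (toℕ i)
  below j<N pj = fromℕ< j<N , subst P (≡-sym (FP.toℕ-fromℕ< j<N)) pj

n≢2+n : ∀ (m : ℕ) → m ≢ suc (suc m)
n≢2+n zero ()
n≢2+n (suc m) e = n≢2+n m (suc-injective e)

parity-suc≢ : ∀ r → suc r % 2 ≢ r % 2
parity-suc≢ zero ()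
parity-suc≢ (suc zero) ()
parity-suc≢ (suc (suc r)) e = parity-suc≢ r (trans (≡-sym ([2+k]%2≡k%2 (suc r))) (trans e ([2+k]%2≡k%2 r)))

module Mod (k : ℕ) where
  P : ℕ
  P = suc k

  %-+ˡ : ∀ a b → (a % P + b) % P ≡ (a + b) % P
  %-+ˡ a b = begin
      (a % P + b) % P           ≡⟨ DM.%-distribˡ-+ (a % P) b P ⟩
      (a % P % P + b % P) % P   ≡⟨ cong (λ z → (z + b % P) % P) (DM.m%n%n≡m%n a P) ⟩
      (a % P + b % P) % P       ≡⟨ ≡-sym (DM.%-distribˡ-+ a b P) ⟩
      (a + b) % P               ∎
    where open ≡-Reasoning

  %-suc : ∀ x → suc (x % P) % P ≡ suc x % P
  %-suc x = trans (cong (_% P) (+-comm 1 (x % P))) (trans (%-+ˡ x 1) (cong (_% P) (+-comm x 1)))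

  %-+P : ∀ x → (x + P) % P ≡ x % P
  %-+P x = DM.[m+n]%n≡m%n x P

  shift≢ : ∀ a m → a < P → 0 < m → m < P → (a + m) % P ≢ a
  shift≢ a m a<P 0<m m<P e with a + m <? P
  ... | yes lt = <-irrefl (≡-sym (trans (≡-sym (DM.m<n⇒m%n≡m lt)) e)) (m<m+n a 0<m)
  ... | no nlt = <-irrefl m≡P m<P
    where
    P≤a+m : P ≤ a + m
    P≤a+m = ≮⇒≥ nlt
    t<P : a + m ∸ P < P
    t<P = +-cancelʳ-< P (a + m ∸ P) P (subst (_< P + P) (≡-sym (m∸n+n≡m P≤a+m)) (+-mono-< a<P m<P))
    t≡a : a + m ∸ P ≡ a
    t≡a = trans (≡-sym (DM.m<n⇒m%n≡m t<P)) (trans (DM.m≤n⇒[n∸m]%m≡n%m P≤a+m) e)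
    m≡P : m ≡ P
    m≡P = +-cancelˡ-≡ a m P (trans (≡-sym (m∸n+n≡m P≤a+m)) (cong (_+ P) t≡a))

  shift-to-top : ∀ s a' → s < P → a' ≤ k → (s + (k ∸ a')) % P ≡ k → s ≡ a'
  shift-to-top s a' s<P a'≤k e with s + (k ∸ a') <? P
  ... | yes lt = +-cancelʳ-≡ (k ∸ a') s a' (trans (≡-sym (DM.m<n⇒m%n≡m lt)) (trans e (≡-sym (m+[n∸m]≡n a'≤k))))
  ... | no nlt = ⊥-elim (<-irrefl refl (≤-trans s<P P≤s))
    where
    c : ℕ
    c = k ∸ a'
    P≤s+c : P ≤ s + c
    P≤s+c = ≮⇒≥ nlt
    t<P : s + c ∸ P < P
    t<P = +-cancelʳ-< P (s + c ∸ P) P (subst (_< P + P) (≡-sym (m∸n+n≡m P≤s+c)) (+-mono-<-≤ s<P (≤-trans (m∸n≤m k a') (n≤1+n k))))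
    t≡k : s + c ∸ P ≡ k
    t≡k = trans (≡-sym (DM.m<n⇒m%n≡m t<P)) (trans (DM.m≤n⇒[n∸m]%m≡n%m P≤s+c) e)
    P≤s : P ≤ s
    P≤s = +-cancelʳ-≤ c P s (begin
        P + c         ≤⟨ +-monoʳ-≤ P (m∸n≤m k a') ⟩
        P + k         ≡⟨ +-comm P k ⟩
        k + P         ≡⟨ cong (_+ P) (≡-sym t≡k) ⟩
        s + c ∸ P + P ≡⟨ m∸n+n≡m P≤s+c ⟩
        s + c         ∎)
      where open ≤-Reasoning


-- Following G - v when every vertex u ≠ v has exactly two neighbours
-- other than v: the non-backtracking walk from an edge st returns to s,
-- closing a cycle w 0, …, w (ℓ - 1) of length ℓ ≥ 3.

module Walk {n} (G : Graph n) (v : Fin n)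
  (atMostTwo : ∀ {c a b e} → c ≢ v → a ≢ v → b ≢ v → e ≢ v →
     T (adj G c a) → T (adj G c b) → T (adj G c e) → a ≡ b ⊎ a ≡ e ⊎ b ≡ e)
  (another : ∀ {c} p → c ≢ v → ∃ λ z → T (adj G c z) × z ≢ v × z ≢ p)
  (s t : Fin n) (s≢v : s ≢ v) (t≢v : t ≢ v) (s~t : T (adj G s t)) where

  next : Fin n → Fin n → Fin n
  next p c with FP.any? (λ z → T? (adj G c z) ×-dec (¬? (z ≟ v) ×-dec ¬? (z ≟ p)))
  ... | yes (z , _) = z
  ... | no _ = v

  next-spec : ∀ p c → c ≢ v → T (adj G c (next p c)) × next p c ≢ v × next p c ≢ p
  next-spec p c c≢v with FP.any? (λ z → T? (adj G c z) ×-dec (¬? (z ≟ v) ×-dec ¬? (z ≟ p)))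
  ... | yes (z , spec) = spec
  ... | no none = ⊥-elim (none (another p c≢v))

  -- consecutive pairs (w k , w (k + 1)) of the walk
  steps : ℕ → Fin n × Fin n
  steps zero = s , t
  steps (suc k) = proj₂ (steps k) , next (proj₁ (steps k)) (proj₂ (steps k))

  w : ℕ → Fin n
  w k = proj₁ (steps k)

  invariant : ∀ k → w k ≢ v × w (suc k) ≢ v × T (adj G (w k) (w (suc k)))
  invariant zero = s≢v , t≢v , s~t
  invariant (suc k) with invariant k
  ... | _ , w₁≢v , _ = w₁≢v , proj₁ (proj₂ spec) , proj₁ spec
    where
    spec : T (adj G (w (suc k)) (w (suc (suc k)))) × w (suc (suc k)) ≢ v × w (suc (suc k)) ≢ w k
    spec = next-spec (w k) (w (suc k)) w₁≢v

  w≢v : ∀ k → w k ≢ v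
  w≢v k = proj₁ (invariant k)

  w-adj : ∀ k → T (adj G (w k) (w (suc k)))
  w-adj k = proj₂ (proj₂ (invariant k))

  no-backtrack : ∀ k → w (suc (suc k)) ≢ w k
  no-backtrack k = proj₂ (proj₂ (next-spec (w k) (w (suc k)) (w≢v (suc k))))

  Repeats : ℕ → Set
  Repeats j = ∃ λ (i : Fin j) → w (toℕ i) ≡ w j

  Repeats? : ∀ j → Dec (Repeats j)
  Repeats? j = FP.any? (λ i → w (toℕ i) ≟ w j)

  some-repeat : ∃ λ k → k < suc n × Repeats k
  some-repeat with FP.pigeonhole (n<1+n n) (λ (i : Fin (suc n)) → w (toℕ i))
  ... | i , j , i<j , e = toℕ j , FP.toℕ<n j , fromℕ< i<j , trans (cong w (FP.toℕ-fromℕ< i<j)) e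

  first-repeat : ∃ λ j → Repeats j × (∀ k → k < j → ¬ Repeats k)
  first-repeat = least Repeats? (suc n) some-repeat

  ℓ : ℕ
  ℓ = proj₁ first-repeat

  w-injective : ∀ a b → a < ℓ → b < ℓ → w a ≡ w b → a ≡ b
  w-injective a b a<ℓ b<ℓ e with <-cmp a b
  ... | tri< lt _ _ = ⊥-elim (proj₂ (proj₂ first-repeat) b b<ℓ (fromℕ< lt , trans (cong w (FP.toℕ-fromℕ< lt)) e))
  ... | tri≈ _ eq _ = eq
  ... | tri> _ _ gt = ⊥-elim (proj₂ (proj₂ first-repeat) a a<ℓ (fromℕ< gt , trans (cong w (FP.toℕ-fromℕ< gt)) (≡-sym e)))

  -- the repeated vertex is w 0: if w ℓ = w (i + 1), then w (i + 1) would have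
  -- three distinct neighbours w i, w (i + 2), w (ℓ - 1) outside v
  repeat-at-start : ∀ i → i < ℓ → w i ≡ w ℓ → i ≡ 0
  repeat-at-start zero _ _ = refl
  repeat-at-start (suc i) i<ℓ e with ℓ | i<ℓ | e | w-injective
  ... | suc j | s≤s i<j | e' | inj = ⊥-elim (three-neighbours (atMostTwo (w≢v (suc i)) (w≢v i) (w≢v (suc (suc i))) (w≢v j)
          (adj-sym G (w-adj i)) (w-adj (suc i)) (subst (λ r → T (adj G r (w j))) (≡-sym e') (adj-sym G (w-adj j)))))
    where
    2+i<1+j : suc (suc i) < suc j
    2+i<1+j with m≤n⇒m<n∨m≡n i<j
    ... | inj₁ lt = s≤s lt
    ... | inj₂ refl = ⊥-elim (adj⇒≢ G (w-adj (suc i)) e')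
    i<1+j : i < suc j
    i<1+j = <-trans (n<1+n i) (<-trans (n<1+n (suc i)) 2+i<1+j)
    three-neighbours : w i ≡ w (suc (suc i)) ⊎ w i ≡ w j ⊎ w (suc (suc i)) ≡ w j → ⊥
    three-neighbours (inj₁ q) = n≢2+n i (inj i (suc (suc i)) i<1+j 2+i<1+j q)
    three-neighbours (inj₂ (inj₁ q)) with inj i j i<1+j (n<1+n j) q
    ... | refl = <-irrefl refl (s≤s i<j)
    three-neighbours (inj₂ (inj₂ q)) with inj (suc (suc i)) j 2+i<1+j (n<1+n j) q
    ... | refl = no-backtrack (suc i) (≡-sym e')

  closes : w ℓ ≡ w 0
  closes = trans (≡-sym e) (cong w (repeat-at-start (toℕ i) (FP.toℕ<n i) e))
    where
    i : Fin ℓ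
    i = proj₁ (proj₁ (proj₂ first-repeat))
    e : w (toℕ i) ≡ w ℓ
    e = proj₂ (proj₁ (proj₂ first-repeat))

  3≤ℓ : 3 ≤ ℓ
  3≤ℓ = length≥3 ℓ closes (≤-trans (s≤s z≤n) (FP.toℕ<n (proj₁ (proj₁ (proj₂ first-repeat)))))
    where
    length≥3 : ∀ r → w r ≡ w 0 → 0 < r → 3 ≤ r
    length≥3 (suc zero) e _ = ⊥-elim (adj⇒≢ G (w-adj 0) (≡-sym e))
    length≥3 (suc (suc zero)) e _ = ⊥-elim (no-backtrack 0 e)
    length≥3 (suc (suc (suc r))) e _ = s≤s (s≤s (s≤s z≤n))

  module Cycle (q : ℕ) (inj : ∀ a b → a < 3 + q → b < 3 + q → w a ≡ w b → a ≡ b) (wP≡w0 : w (3 + q) ≡ w 0)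
    (v-dominating : ∀ y → y ≢ v → T (adj G v y)) where

    P : ℕ
    P = 3 + q

    succᶜ : ℕ → ℕ
    succᶜ a with suc a ℕ.≟ P
    ... | yes _ = 0
    ... | no _ = suc a

    predᶜ : ℕ → ℕ
    predᶜ zero = 2 + q
    predᶜ (suc a) = a

    succᶜ<P : ∀ a → a < P → succᶜ a < P
    succᶜ<P a a<P with suc a ℕ.≟ P
    ... | yes _ = s≤s z≤n
    ... | no ne = ≤∧≢⇒< a<P ne

    predᶜ<P : ∀ a → a < P → predᶜ a < P
    predᶜ<P zero _ = ≤-refl
    predᶜ<P (suc a) a<P = <-trans (n<1+n a) a<P

    w-succᶜ : ∀ a → w (succᶜ a) ≡ w (suc a)
    w-succᶜ a with suc a ℕ.≟ P
    ... | yes e = ≡-sym (trans (cong w e) wP≡w0)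
    ... | no _ = refl

    adj-succᶜ : ∀ a → T (adj G (w a) (w (succᶜ a)))
    adj-succᶜ a = subst (λ z → T (adj G (w a) z)) (≡-sym (w-succᶜ a)) (w-adj a)

    adj-predᶜ : ∀ a → T (adj G (w (predᶜ a)) (w a))
    adj-predᶜ zero = subst (λ z → T (adj G (w (2 + q)) z)) wP≡w0 (w-adj (2 + q))
    adj-predᶜ (suc a) = w-adj a

    succᶜ≢predᶜ : ∀ a → a < P → succᶜ a ≢ predᶜ a
    succᶜ≢predᶜ zero _ ()
    succᶜ≢predᶜ (suc a) a<P e with suc (suc a) ℕ.≟ P
    succᶜ≢predᶜ (suc .zero) a<P refl | yes ()
    ... | no _ = n≢2+n a (≡-sym e)

    succᶜ≡ : ∀ a → a < P → succᶜ a ≡ suc a % P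
    succᶜ≡ a a<P with suc a ℕ.≟ P
    ... | yes e = ≡-sym (trans (cong (_% P) e) (DM.n%n≡0 P))
    ... | no ne = ≡-sym (DM.m<n⇒m%n≡m (≤∧≢⇒< a<P ne))

    succᶜ-predᶜ : ∀ a → a < P → succᶜ (predᶜ a) ≡ a
    succᶜ-predᶜ zero _ with suc (2 + q) ℕ.≟ P
    ... | yes _ = refl
    ... | no ne = ⊥-elim (ne refl)
    succᶜ-predᶜ (suc a) a<P with suc a ℕ.≟ P
    ... | yes e = ⊥-elim (<-irrefl e a<P)
    ... | no _ = refl

    cycle-neighbours : ∀ a z → a < P → z ≢ v → T (adj G (w a) z) → z ≡ w (succᶜ a) ⊎ z ≡ w (predᶜ a)
    cycle-neighbours a z a<P z≢v az
      with atMostTwo (w≢v a) z≢v (w≢v (succᶜ a)) (w≢v (predᶜ a)) az (adj-succᶜ a) (adj-sym G (adj-predᶜ a))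
    ... | inj₁ e = inj₁ e
    ... | inj₂ (inj₁ e) = inj₂ e
    ... | inj₂ (inj₂ e) = ⊥-elim (succᶜ≢predᶜ a a<P (inj (succᶜ a) (predᶜ a) (succᶜ<P a a<P) (predᶜ<P a a<P) e))

    w≢w0 : ∀ k → 0 < k → k < P → w k ≢ w 0
    w≢w0 k 0<k k<P e with inj k 0 k<P (s≤s z≤n) e
    ... | refl = <-irrefl refl 0<k

    -- An even cycle makes G 3-colourable: in a 2-colouring β of G - v - w 0
    -- the path w 1 … w (P - 1) alternates, so both cycle neighbours of w 0
    -- get β (w 1); give w 0 the other colour and v the third colour.
    even⇒3colourable : ColouringMinus2 G v (w 0) 2 → P % 2 ≢ 1 → Colourable G allV 3
    even⇒3colourable (β , β-proper) even = proper3⇒colourable {G = G} colour proper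
      where
      c : ℕ → Fin 2
      c k = β (w (suc k))
      differ : ∀ k → k < 1 + q → c k ≢ c (suc k)
      differ k k<1+q = β-proper (w (suc k)) (w (2 + k)) (w≢v (suc k)) (w≢w0 (suc k) (s≤s z≤n) (s≤s (m≤n⇒m≤1+n k<1+q)))
        (w≢v (2 + k)) (w≢w0 (2 + k) (s≤s z≤n) (s≤s (s≤s k<1+q))) (w-adj (suc k))
      alternates : ∀ k → 2 + k ≤ 1 + q → c (2 + k) ≡ c k
      alternates k le = ≡-sym (fin2-alternate (c k) (c (1 + k)) (c (2 + k)) (differ k (m+n≤o⇒n≤o 1 le)) (differ (1 + k) le))
      ends-agree : β (w (2 + q)) ≡ β (w 1)
      ends-agree = trans (period2 c (1 + q) alternates (1 + q) ≤-refl)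
                         (cong c (%2≢1⇒%2≡0 (1 + q) (λ odd → even (trans ([2+k]%2≡k%2 (1 + q)) odd))))
      colour : Fin n → Fin 3
      colour y with y ≟ v | y ≟ w 0
      ... | yes _ | _ = c2
      ... | no _ | yes _ = emb (flip (β (w 1)))
      ... | no _ | no _ = emb (β y)
      nb-w0 : ∀ b → b ≢ v → T (adj G (w 0) b) → β b ≡ β (w 1)
      nb-w0 b b≢v ab with cycle-neighbours 0 b (s≤s z≤n) b≢v ab
      ... | inj₁ e = cong β e
      ... | inj₂ e = trans (cong β e) ends-agree
      proper : Proper3 G colour
      proper a b ab with a ≟ v | a ≟ w 0 | b ≟ v | b ≟ w 0
      ... | yes refl | _ | yes refl | _ = λ _ → adj⇒≢ G ab refl
      ... | yes _ | _ | no _ | yes _ = λ e → emb≢c2 _ (≡-sym e)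
      ... | yes _ | _ | no _ | no _ = λ e → emb≢c2 _ (≡-sym e)
      ... | no _ | yes _ | yes _ | _ = emb≢c2 _
      ... | no _ | no _ | yes _ | _ = emb≢c2 _
      ... | no _ | yes refl | no _ | yes refl = λ _ → adj⇒≢ G ab refl
      ... | no _ | yes refl | no b≢v | no _ = λ e → flip≢ (β (w 1)) (trans (FP.inject₁-injective e) (nb-w0 b b≢v ab))
      ... | no a≢v | no _ | no _ | yes refl = λ e → flip≢ (β (w 1)) (trans (FP.inject₁-injective (≡-sym e)) (nb-w0 a a≢v (adj-sym G ab)))
      ... | no a≢v | no a≢w0 | no b≢v | no b≢w0 = λ e → β-proper a b a≢v a≢w0 b≢v b≢w0 ab (FP.inject₁-injective e)

    -- An odd cycle meets every vertex y ≠ v: otherwise a 3-colouring γ of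
    -- G - y would 2-colour the odd cycle with the colours other than γ v.
    odd⇒spanning : ∀ y → y ≢ v → (∀ k → k < P → w k ≢ y) → ColouringMinus1 G y 3 → P % 2 ≡ 1 → ⊥
    odd⇒spanning y y≢v off (γ , γ-proper) odd = differ 0 (s≤s z≤n) (begin
        c 0        ≡⟨ cong γ (≡-sym wP≡w0) ⟩
        c P        ≡⟨ period2 c P alternates P ≤-refl ⟩
        c (P % 2)  ≡⟨ cong c odd ⟩
        c 1        ∎)
      where
      open ≡-Reasoning
      c : ℕ → Fin 3
      c k = γ (w k)
      w≢y : ∀ k → k ≤ P → w k ≢ y
      w≢y k k≤P with m≤n⇒m<n∨m≡n k≤P
      ... | inj₁ lt = off k lt
      ... | inj₂ refl = λ e → off 0 (s≤s z≤n) (trans (≡-sym wP≡w0) e)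
      ≢γv : ∀ k → k ≤ P → c k ≢ γ v
      ≢γv k k≤P = γ-proper (w k) v (w≢y k k≤P) (≢-sym y≢v) (adj-sym G (v-dominating (w k) (w≢v k)))
      differ : ∀ k → k < P → c k ≢ c (suc k)
      differ k k<P = γ-proper (w k) (w (suc k)) (w≢y k (<⇒≤ k<P)) (w≢y (suc k) k<P) (w-adj k)
      alternates : ∀ k → 2 + k ≤ P → c (2 + k) ≡ c k
      alternates k le = ≡-sym (fin3-two-values (c k) (c (1 + k)) (c (2 + k)) (γ v)
        (≢γv k (m+n≤o⇒n≤o 2 le)) (≢γv (1 + k) (m+n≤o⇒n≤o 1 le)) (≢γv (2 + k) le) (differ k (m+n≤o⇒n≤o 1 le)) (differ (1 + k) le))

    module Spanning (odd : P % 2 ≡ 1) (onto : ∀ y → y ≢ v → ∃ λ k → k < P × w k ≡ y) where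

      V : Set
      V = Sub (Fin n) (minus1 v)

      toV : Fin P → V
      toV i = ⟨ w (toℕ i) , w≢v (toℕ i) ⟩

      found : ∀ y → y ≢ v → Σ (Fin P) λ i → w (toℕ i) ≡ y
      found y y≢v with onto y y≢v
      ... | k , k<P , wk≡y = fromℕ< k<P , trans (cong w (FP.toℕ-fromℕ< k<P)) wk≡y

      -- the position of y on the cycle, computed without using y ≢ v
      position : ∀ y → .(y ≢ v) → Σ (Fin P) λ i → w (toℕ i) ≡ y
      position y y≢v with FP.any? (λ (i : Fin P) → w (toℕ i) ≟ y)
      ... | yes p = p
      ... | no none = ⊥-elim-irr (none (found y y≢v))

      fromV : V → Fin P
      fromV ⟨ y , y≢v ⟩ = proj₁ (position y y≢v)

      w-fromV : ∀ x → w (toℕ (fromV x)) ≡ elt x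
      w-fromV ⟨ y , y≢v ⟩ = proj₂ (position y y≢v)

      isomorphism : Fin P ↔ V
      isomorphism = record
        { to = toV
        ; from = fromV
        ; to-cong = cong toV
        ; from-cong = cong fromV
        ; inverse = (λ {x} e → trans (cong toV e) (Sub-≡ (w-fromV x)))
                  , (λ {i} e → trans (cong fromV e)
                      (FP.toℕ-injective (inj _ _ (FP.toℕ<n (fromV (toV i))) (FP.toℕ<n i) (w-fromV (toV i)))))
        }

      adjacency : ∀ i j → T (adj G (elt (Inverse.to isomorphism i)) (elt (Inverse.to isomorphism j))) ⇔ CycleAdj (2 + q) i j
      adjacency i j = mk⇔ forward backward
        where
        forward : T (adj G (w (toℕ i)) (w (toℕ j))) → CycleAdj (2 + q) i j
        forward a with cycle-neighbours (toℕ i) (w (toℕ j)) (FP.toℕ<n i) (w≢v (toℕ j)) a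
        ... | inj₁ e = inj₁ (trans (inj _ _ (FP.toℕ<n j) (succᶜ<P _ (FP.toℕ<n i)) e) (succᶜ≡ _ (FP.toℕ<n i)))
        ... | inj₂ e = inj₂ (trans (≡-sym (succᶜ-predᶜ _ (FP.toℕ<n i)))
                            (trans (cong succᶜ (≡-sym (inj _ _ (FP.toℕ<n j) (predᶜ<P _ (FP.toℕ<n i)) e))) (succᶜ≡ _ (FP.toℕ<n j))))
        backward : CycleAdj (2 + q) i j → T (adj G (w (toℕ i)) (w (toℕ j)))
        backward (inj₁ e) = subst (λ z → T (adj G (w (toℕ i)) (w z))) (≡-sym (trans e (≡-sym (succᶜ≡ _ (FP.toℕ<n i))))) (adj-succᶜ (toℕ i))
        backward (inj₂ e) = adj-sym G (subst (λ z → T (adj G (w (toℕ j)) (w z))) (≡-sym (trans e (≡-sym (succᶜ≡ _ (FP.toℕ<n j))))) (adj-succᶜ (toℕ j)))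

      -- v together with the cycle accounts for all n vertices, so P ≥ n - 1 ≥ 4, and P is odd
      P≥5 : 5 ≤ n → 5 ≤ P
      P≥5 5≤n = bound q (FP.injective⇒≤ {f = code} code-injective) odd
        where
        code : Fin n → Fin (suc P)
        code y with y ≟ v
        ... | yes _ = zero
        ... | no y≢v = suc (fromV ⟨ y , y≢v ⟩)
        code-injective : ∀ {a b} → code a ≡ code b → a ≡ b
        code-injective {a} {b} e with a ≟ v | b ≟ v | e
        ... | yes refl | yes refl | _ = refl
        ... | yes _ | no _ | ()
        ... | no _ | yes _ | ()
        ... | no a≢v | no b≢v | e' = trans (≡-sym (w-fromV ⟨ a , a≢v ⟩)) (trans (cong (w ∘ toℕ) (FP.suc-injective e')) (w-fromV ⟨ b , b≢v ⟩))
        bound : ∀ r → n ≤ 4 + r → (3 + r) % 2 ≡ 1 → 5 ≤ 3 + r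
        bound zero n≤4 _ = ⊥-elim (<-irrefl refl (≤-trans 5≤n n≤4))
        bound (suc zero) _ ()
        bound (suc (suc r)) _ _ = s≤s (s≤s (s≤s (s≤s (s≤s z≤n))))

      oddCycle : 5 ≤ n → GminusVIsOddCycle≥5 G v
      oddCycle 5≤n = 2 + q , P≥5 5≤n , odd , isomorphism , adjacency

-- Equality forces an odd wheel

module EqualityCase {n} (G : Graph n) (cr : Critical 4 G) (nc : NonComplete G)
  (d : ℕ) (g : HasSize (DCEdge G) d) (tight : 2 * d ≡ edgeCount G) where
  open DoubleCriticalEdges G cr nc d g
  open Critical4 {G = G} cr
  open Inverse g using (to)

  module Centre (v : Fin n) (star : ∀ i → Mem v (E i)) where
    open StarAt v star

    equalities : (deg v ≡ d) × (suc (deg v) ≡ n) × (∑ rest + 3 ≡ n * 3)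
    equalities = star-bound-tight d (deg v) (∑ rest) n (edgeCount G) d≤deg (degree<n G v) rest-bound deg+rest tight

    degree-v : degree G v ≡ n ∸ 1
    degree-v = trans (degree≡count G v) (cong (_∸ 1) (proj₁ (proj₂ equalities)))

    v-dominating : ∀ y → y ≢ v → T (adj G v y)
    v-dominating = dominating G v (≤-reflexive (≡-sym (proj₁ (proj₂ equalities))))

    -- every other vertex has degree 3, since the degrees outside v sum to 3(n - 1)
    deg≤3 : ∀ c → c ≢ v → deg c ≤ 3
    deg≤3 c c≢v with deg c ≤? 3
    ... | yes p = p
    ... | no deg>3 = ⊥-elim (<-irrefl refl (begin-strict
        n * 3                                ≡⟨ ≡-sym (∑-const {n} 3) ⟩
        ∑ three                              <⟨ subst (∑ three <_) (cong (∑ three +_) (≡-sym (count-δ c))) (m<m+n (∑ three) (s≤s z≤n)) ⟩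
        ∑ three + count (δ c)                ≡⟨ ≡-sym (∑-+ three (λ y → ind (δ c y))) ⟩
        ∑ (λ y → 3 + ind (δ c y))            ≤⟨ ∑-mono pointwise ⟩
        ∑ (λ y → rest y + ind (δ v y) * 3)   ≡⟨ rest+3 ⟩
        ∑ rest + 3                           ≡⟨ proj₂ (proj₂ equalities) ⟩
        n * 3                                ∎))
      where
      open ≤-Reasoning
      three : Fin n → ℕ
      three _ = 3
      pointwise : ∀ y → 3 + ind (δ c y) ≤ rest y + ind (δ v y) * 3
      pointwise y with v ≟ y | c ≟ y
      ... | yes refl | yes refl = ⊥-elim (c≢v refl)
      ... | yes refl | no _ = ≤-refl
      ... | no _ | yes refl = subst (4 ≤_) (≡-sym (+-identityʳ (deg c))) (≰⇒> deg>3)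
      ... | no _ | no _ = subst₂ _≤_ (≡-sym (+-identityʳ 3)) (≡-sym (+-identityʳ (deg y))) (minDegree y)

    atMostTwo : ∀ {c a b e} → c ≢ v → a ≢ v → b ≢ v → e ≢ v →
      T (adj G c a) → T (adj G c b) → T (adj G c e) → a ≡ b ⊎ a ≡ e ⊎ b ≡ e
    atMostTwo {c} {a} {b} {e} c≢v a≢v b≢v e≢v ca cb ce with a ≟ b | a ≟ e | b ≟ e
    ... | yes x | _ | _ = inj₁ x
    ... | no _ | yes x | _ = inj₂ (inj₁ x)
    ... | no _ | no _ | yes x = inj₂ (inj₂ x)
    ... | no ab | no ae | no be = ⊥-elim (<-irrefl refl (≤-trans (count-≥ (adj G c) (quad v a b e)
        (quad-injective (≢-sym a≢v) (≢-sym b≢v) (≢-sym e≢v) ab ae be) nbrs) (deg≤3 c c≢v)))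
      where
      nbrs : ∀ i → T (adj G c (quad v a b e i))
      nbrs zero = adj-sym G (v-dominating c c≢v)
      nbrs (suc zero) = ca
      nbrs (suc (suc zero)) = cb
      nbrs (suc (suc (suc zero))) = ce

    another : ∀ {c} p → c ≢ v → ∃ λ z → T (adj G c z) × z ≢ v × z ≢ p
    another {c} p c≢v with FP.any? (λ z → T? (adj G c z) ×-dec (¬? (z ≟ v) ×-dec ¬? (z ≟ p)))
    ... | yes r = r
    ... | no none = ⊥-elim (<-irrefl refl (≤-trans (minDegree c) (subst (count (adj G c) ≤_) two (∑-mono pointwise))))
      where
      pointwise : ∀ y → ind (adj G c y) ≤ ind (δ v y) + ind (δ p y)
      pointwise y with v ≟ y | p ≟ y
      ... | yes _ | _ = ≤-trans (ind≤1 (adj G c y)) (m≤m+n 1 _)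
      ... | no _ | yes _ = subst (ind (adj G c y) ≤_) (≡-sym (+-identityˡ 1)) (ind≤1 (adj G c y))
      ... | no y≢v | no y≢p with T? (adj G c y)
      ...   | no c≁y rewrite ¬T⇒false c≁y = z≤n
      ...   | yes c~y = ⊥-elim (none (y , c~y , ≢-sym y≢v , ≢-sym y≢p))
      two : ∑ (λ y → ind (δ v y) + ind (δ p y)) ≡ 2
      two = trans (∑-+ (λ y → ind (δ v y)) (λ y → ind (δ p y))) (cong₂ _+_ (count-δ v) (count-δ p))

    orient : ∀ {c x y} → (v ≡ x × c ≡ y) ⊎ (v ≡ y × c ≡ x) → ColouringMinus2 G x y 2 → ColouringMinus2 G v c 2
    orient (inj₁ (refl , refl)) t = t
    orient (inj₂ (refl , refl)) t = swapMinus2 {G = G} t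

    -- every spoke vc is double-critical: otherwise the d double-critical edges
    -- would use only d - 1 of the d neighbours of v
    spoke-colouring : ∀ c → c ≢ v → ¬ ¬ ColouringMinus2 G v c 2
    spoke-colouring c c≢v none with FP.any? (λ i → Mem? v (E i) ×-dec Mem? c (E i))
    ... | yes (i , v∈ , c∈) = recover {Q = λ e → Mem v e → Mem c e → ⊥} (to i)
          (λ e p v∈e c∈e → none (orient (two-members e (≢-sym c≢v) v∈e c∈e) (dcColouring (proj₂ p))))
          (λ e → Mem? v e →-dec Mem? c e →-dec no (λ ())) v∈ c∈
    ... | no c∉ = <-irrefl refl (≤-trans (s≤s (count-≥ P spoke spoke-injective spoke-P))
                     (≤-reflexive (trans (+-comm 1 (count P)) (trans count-P (proj₁ equalities)))))
      where
      P : Fin n → Bool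
      P y = adj G v y ∧ not (δ c y)
      spoke-P : ∀ i → T (P (spoke i))
      spoke-P i with c ≟ spoke i
      ... | yes e = ⊥-elim (c∉ (i , star i , subst (λ z → Mem z (E i)) (≡-sym e) (other-mem (E i))))
      ... | no _ rewrite ∧-identityʳ (adj G v (spoke i)) = other-adj (E i) (star i) (E-adj i)
      count-P : count P + 1 ≡ deg v
      count-P = trans (cong (count P +_) (≡-sym (count-δ c))) (trans (≡-sym (∑-+ (λ y → ind (P y)) (λ y → ind (δ c y)))) (∑-ext pointwise))
        where
        pointwise : ∀ y → ind (P y) + ind (δ c y) ≡ ind (adj G v y)
        pointwise y with c ≟ y
        ... | yes refl rewrite ∧-zeroʳ (adj G v c) | T⇒true (v-dominating c c≢v) = refl
        ... | no _ rewrite ∧-identityʳ (adj G v y) = +-identityʳ _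

    s : Fin n
    s with proj₁ nc ≟ v
    ... | yes _ = proj₁ (proj₂ nc)
    ... | no _ = proj₁ nc

    s≢v : s ≢ v
    s≢v with proj₁ nc ≟ v
    ... | yes refl = ≢-sym (proj₁ (proj₂ (proj₂ nc)))
    ... | no a≢v = a≢v

    t : Fin n
    t = proj₁ (another v s≢v)

    open Walk G v atMostTwo another s t s≢v (proj₁ (proj₂ (proj₂ (another v s≢v)))) (proj₁ (proj₂ (another v s≢v)))

    module Closed (q : ℕ) (inj : ∀ a b → a < 3 + q → b < 3 + q → w a ≡ w b → a ≡ b) (wP≡w0 : w (3 + q) ≡ w 0) where
      open Cycle q inj wP≡w0 v-dominating

      odd : P % 2 ≡ 1
      odd with P % 2 ℕ.≟ 1
      ... | yes e = e
      ... | no even = ⊥-elim (spoke-colouring (w 0) (w≢v 0) (λ β → not3colourable (even⇒3colourable β even)))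

      onto : ∀ y → y ≢ v → ∃ λ k → k < P × w k ≡ y
      onto y y≢v with FP.any? (λ (i : Fin P) → w (toℕ i) ≟ y)
      ... | yes (i , e) = toℕ i , FP.toℕ<n i , e
      ... | no off = ⊥-elim (odd⇒spanning y y≢v (λ k k<P e → off (fromℕ< k<P , trans (cong w (FP.toℕ-fromℕ< k<P)) e)) (colourMinus y) odd)

      wheel : GminusVIsOddCycle≥5 G v
      wheel = Spanning.oddCycle odd onto 5≤n

    wheel : GminusVIsOddCycle≥5 G v
    wheel = Closed.wheel (ℓ ∸ 3) (λ a b a<P b<P → w-injective a b (subst (a <_) 3+q≡ℓ a<P) (subst (b <_) 3+q≡ℓ b<P))
                                 (trans (cong w 3+q≡ℓ) closes)
      where
      3+q≡ℓ : 3 + (ℓ ∸ 3) ≡ ℓ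
      3+q≡ℓ = m+[n∸m]≡n 3≤ℓ

  equality⇒wheel : ∃ λ (v : Fin n) → degree G v ≡ n ∸ 1 × GminusVIsOddCycle≥5 G v
  equality⇒wheel with starOrSmall-DC
  ... | inj₂ d≤3 = ⊥-elim (<-irrefl tight (small-family d n (edgeCount G) d≤3 5≤n 3n≤2m))
  ... | inj₁ (v , star) = v , Centre.degree-v v star , Centre.wheel v star

-- In an odd wheel exactly the spokes are double-critical, so 2d = m

injection-from-others : ∀ {n d} (v : Fin n) (h : ∀ y → y ≢ v → Fin d) →
  (∀ y y' y≢v y'≢v → h y y≢v ≡ h y' y'≢v → y ≡ y') → n ∸ 1 ≤ d
injection-from-others {suc n} v h inj =
  FP.injective⇒≤ {f = λ i → h (punchIn v i) (FP.punchInᵢ≢i v i)} (λ {i} {j} e → FP.punchIn-injective v i j (inj _ _ _ _ e))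

swapColourable : ∀ {n} {G : Graph n} {x y j} → Colourable G (minus2 x y) j → Colourable G (minus2 y x) j
swapColourable (c , p) = (λ u s → c u (proj₂ s , proj₁ s)) , λ a b sa sb ab → p a b (proj₂ sa , proj₁ sa) (proj₂ sb , proj₁ sb) ab

module Wheel {n} (G : Graph n) (cr : Critical 4 G) (nc : NonComplete G) (d : ℕ) (g : HasSize (DCEdge G) d)
  (v : Fin n) (degree-v : degree G v ≡ n ∸ 1) (k : ℕ) (5≤P : 5 ≤ suc k)
  (f : Fin (suc k) ↔ Sub (Fin n) (minus1 v))
  (cycle : ∀ i j → T (adj G (elt (Inverse.to f i)) (elt (Inverse.to f j))) ⇔ CycleAdj k i j) where
  open DoubleCriticalEdges G cr nc d g
  open Critical4 {G = G} cr
  open Mod k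
  open Equivalence using () renaming (to to ⇒; from to ⇐)

  pos : ℕ → Fin P
  pos x = fromℕ< (DM.m%n<n x P)

  U : ℕ → Fin n
  U x = elt (Inverse.to f (pos x))

  toℕ-pos : ∀ x → toℕ (pos x) ≡ x % P
  toℕ-pos x = FP.toℕ-fromℕ< _

  U≢v : ∀ x → U x ≢ v
  U≢v x = recover (Inverse.to f (pos x)) (λ _ p → p) (λ z → ¬? (z ≟ v))

  U-cong : ∀ x y → x % P ≡ y % P → U x ≡ U y
  U-cong x y e = cong (λ i → elt (Inverse.to f i)) (FP.toℕ-injective (trans (toℕ-pos x) (trans e (≡-sym (toℕ-pos y)))))

  U-injective : ∀ x y → U x ≡ U y → x % P ≡ y % P
  U-injective x y e = trans (≡-sym (toℕ-pos x)) (trans (cong toℕ (enumeration-injective f _ _ e)) (toℕ-pos y))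

  index : ∀ y → y ≢ v → ℕ
  index y y≢v = toℕ (Inverse.from f ⟨ y , y≢v ⟩)

  U-index : ∀ y y≢v → U (index y y≢v) ≡ y
  U-index y y≢v = trans (U-cong (toℕ i) (toℕ i) refl) (trans (cong (λ j → elt (Inverse.to f j)) pos-i) (cong elt (Inverse.inverseˡ f refl)))
    where
    i : Fin P
    i = Inverse.from f ⟨ y , y≢v ⟩
    pos-i : pos (toℕ i) ≡ i
    pos-i = FP.toℕ-injective (trans (toℕ-pos (toℕ i)) (DM.m<n⇒m%n≡m (FP.toℕ<n i)))

  U-adj : ∀ x y → T (adj G (U x) (U y)) ⇔ (y % P ≡ suc x % P ⊎ x % P ≡ suc y % P)
  U-adj x y = mk⇔ forward backward
    where
    suc≡ : ∀ z → suc (toℕ (pos z)) % P ≡ suc z % P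
    suc≡ z = trans (cong (λ r → suc r % P) (toℕ-pos z)) (%-suc z)
    forward : T (adj G (U x) (U y)) → y % P ≡ suc x % P ⊎ x % P ≡ suc y % P
    forward a with ⇒ (cycle (pos x) (pos y)) a
    ... | inj₁ e = inj₁ (trans (≡-sym (toℕ-pos y)) (trans e (suc≡ x)))
    ... | inj₂ e = inj₂ (trans (≡-sym (toℕ-pos x)) (trans e (suc≡ y)))
    backward : y % P ≡ suc x % P ⊎ x % P ≡ suc y % P → T (adj G (U x) (U y))
    backward (inj₁ e) = ⇐ (cycle (pos x) (pos y)) (inj₁ (trans (toℕ-pos y) (trans e (≡-sym (suc≡ x)))))
    backward (inj₂ e) = ⇐ (cycle (pos x) (pos y)) (inj₂ (trans (toℕ-pos x) (trans e (≡-sym (suc≡ y)))))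

  adj-suc : ∀ x → T (adj G (U x) (U (suc x)))
  adj-suc x = ⇐ (U-adj x (suc x)) (inj₁ refl)

  -- x + k is the predecessor of x modulo P
  prev : ℕ → ℕ
  prev x = x + k

  suc-prev : ∀ x → suc (prev x) % P ≡ x % P
  suc-prev x = trans (cong (_% P) (≡-sym (+-suc x k))) (%-+P x)

  adj-prev : ∀ x → T (adj G (U x) (U (prev x)))
  adj-prev x = ⇐ (U-adj x (prev x)) (inj₂ (≡-sym (suc-prev x)))

  rim-neighbours : ∀ x z → z ≢ v → T (adj G (U x) z) → z ≡ U (suc x) ⊎ z ≡ U (prev x)
  rim-neighbours x z z≢v a with ⇒ (U-adj x (index z z≢v)) (subst (λ r → T (adj G (U x) r)) (≡-sym (U-index z z≢v)) a)
  ... | inj₁ e = inj₁ (trans (≡-sym (U-index z z≢v)) (U-cong (index z z≢v) (suc x) e))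
  ... | inj₂ e = inj₂ (trans (≡-sym (U-index z z≢v)) (U-cong (index z z≢v) (prev x) (≡-sym prev≡)))
    where
    y : ℕ
    y = index z z≢v
    prev≡ : prev x % P ≡ y % P
    prev≡ = begin
        (x + k) % P           ≡⟨ ≡-sym (%-+ˡ x k) ⟩
        (x % P + k) % P       ≡⟨ cong (λ r → (r + k) % P) e ⟩
        (suc y % P + k) % P   ≡⟨ %-+ˡ (suc y) k ⟩
        (suc y + k) % P       ≡⟨ cong (_% P) (≡-sym (+-suc y k)) ⟩
        (y + P) % P           ≡⟨ %-+P y ⟩
        y % P                 ∎
      where open ≡-Reasoning

  U-shift≢ : ∀ b m → 0 < m → m < P → U (m + b) ≢ U b
  U-shift≢ b m 0<m m<P e =
    shift≢ (b % P) m (DM.m%n<n b P) 0<m m<P (trans (%-+ˡ b m) (trans (cong (_% P) (+-comm b m)) (U-injective (m + b) b e)))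

  suc≢prev : ∀ x → U (suc x) ≢ U (prev x)
  suc≢prev x e = shift≢ (suc x % P) (k ∸ 1) (DM.m%n<n (suc x) P) 0<k-1 (s≤s (m∸n≤m k 1))
    (trans (%-+ˡ (suc x) (k ∸ 1)) (trans (cong (_% P) shift) (≡-sym (U-injective (suc x) (prev x) e))))
    where
    1+[k-1]≡k : suc (k ∸ 1) ≡ k
    1+[k-1]≡k = m+[n∸m]≡n {1} {k} (≤-trans (s≤s z≤n) (s≤s⁻¹ 5≤P))
    0<k-1 : 0 < k ∸ 1
    0<k-1 = ≤-trans (s≤s z≤n) (s≤s⁻¹ (s≤s⁻¹ (subst (5 ≤_) (cong suc (≡-sym 1+[k-1]≡k)) 5≤P)))
    shift : suc x + (k ∸ 1) ≡ x + k
    shift = trans (≡-sym (+-suc x (k ∸ 1))) (cong (x +_) 1+[k-1]≡k)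

  v-dominating : ∀ y → y ≢ v → T (adj G v y)
  v-dominating = dominating G v (subst (λ r → n ≤ suc r) (trans (≡-sym degree-v) (degree≡count G v)) (n≤1+n∸1 n))
    where
    n≤1+n∸1 : ∀ m → m ≤ suc (m ∸ 1)
    n≤1+n∸1 zero = z≤n
    n≤1+n∸1 (suc m) = s≤s ≤-refl

  ind-δ≢ : ∀ {a z : Fin n} → a ≢ z → ind (δ a z) ≡ 0
  ind-δ≢ {a} {z} ne with a ≟ z
  ... | yes e = ⊥-elim (ne e)
  ... | no _ = refl

  deg-U : ∀ x → deg (U x) ≡ 3
  deg-U x = trans (∑-ext pointwise) (trans (∑-+ (λ z → ind (δ v z) + ind (δ a z)) (λ z → ind (δ b z)))
              (cong₂ _+_ (trans (∑-+ (λ z → ind (δ v z)) (λ z → ind (δ a z))) (cong₂ _+_ (count-δ v) (count-δ a))) (count-δ b)))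
    where
    a b : Fin n
    a = U (suc x)
    b = U (prev x)
    pointwise : ∀ z → ind (adj G (U x) z) ≡ ind (δ v z) + ind (δ a z) + ind (δ b z)
    pointwise z with v ≟ z
    ... | yes refl rewrite T⇒true (adj-sym G (v-dominating (U x) (U≢v x))) | ind-δ≢ (U≢v (suc x)) | ind-δ≢ (U≢v (prev x)) = refl
    ... | no v≢z with a ≟ z | b ≟ z
    ...   | yes refl | yes e = ⊥-elim (suc≢prev x (≡-sym e))
    ...   | yes refl | no _ rewrite T⇒true (adj-suc x) = refl
    ...   | no _ | yes refl rewrite T⇒true (adj-prev x) = refl
    ...   | no a≢z | no b≢z with T? (adj G (U x) z)
    ...     | no x≁z rewrite ¬T⇒false x≁z = refl
    ...     | yes x~z with rim-neighbours x z (≢-sym v≢z) x~z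
    ...       | inj₁ e = ⊥-elim (a≢z (≡-sym e))
    ...       | inj₂ e = ⊥-elim (b≢z (≡-sym e))

  deg-rim : ∀ y → y ≢ v → deg y ≡ 3
  deg-rim y y≢v = subst (λ r → deg r ≡ 3) (U-index y y≢v) (deg-U (index y y≢v))

  1<P : 1 < P
  1<P = ≤-trans (s≤s (s≤s z≤n)) 5≤P
  2<P : 2 < P
  2<P = ≤-trans (s≤s (s≤s (s≤s z≤n))) 5≤P
  3<P : 3 < P
  3<P = ≤-trans (s≤s (s≤s (s≤s (s≤s z≤n)))) 5≤P

  -- a rim edge is not double-critical: v, U (b + 2), U (b + 3) form a
  -- triangle in G - U b - U (b + 1)
  rim-not-dc : ∀ b → ¬ ColouringMinus2 G (U b) (U (suc b)) 2
  rim-not-dc b (β , β-proper) = v≢c' (fin2-alternate (β v) (β c) (β c') v≢c c≢c')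
    where
    c c' : Fin n
    c = U (2 + b)
    c' = U (3 + b)
    v≢U0 : v ≢ U b
    v≢U0 = ≢-sym (U≢v b)
    v≢U1 : v ≢ U (suc b)
    v≢U1 = ≢-sym (U≢v (suc b))
    c≢U0 : c ≢ U b
    c≢U0 = U-shift≢ b 2 (s≤s z≤n) 2<P
    c≢U1 : c ≢ U (suc b)
    c≢U1 = U-shift≢ (suc b) 1 (s≤s z≤n) 1<P
    c'≢U0 : c' ≢ U b
    c'≢U0 = U-shift≢ b 3 (s≤s z≤n) 3<P
    c'≢U1 : c' ≢ U (suc b)
    c'≢U1 = U-shift≢ (suc b) 2 (s≤s z≤n) 2<P
    v≢c : β v ≢ β c
    v≢c = β-proper v c v≢U0 v≢U1 c≢U0 c≢U1 (v-dominating c (U≢v (2 + b)))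
    v≢c' : β v ≢ β c'
    v≢c' = β-proper v c' v≢U0 v≢U1 c'≢U0 c'≢U1 (v-dominating c' (U≢v (3 + b)))
    c≢c' : β c ≢ β c'
    c≢c' = β-proper c c' c≢U0 c≢U1 c'≢U0 c'≢U1 (adj-suc (2 + b))

  -- a rim edge xy is never double-critical: it is U a U (a + 1) or U (a - 1) U a
  rim-dc-absurd : ∀ x y → x ≢ v → y ≢ v → DoubleCritical G x y → ⊥
  rim-dc-absurd x y x≢v y≢v dc =
    byPosition (rim-neighbours a y y≢v (subst (λ r → T (adj G r y)) (≡-sym (U-index x x≢v)) (proj₁ dc)))
    where
    a : ℕ
    a = index x x≢v
    x≡Ua : x ≡ U a
    x≡Ua = ≡-sym (U-index x x≢v)
    byPosition : y ≡ U (suc a) ⊎ y ≡ U (prev a) → ⊥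
    byPosition (inj₁ e) = rim-not-dc a (subst₂ (λ r s → ColouringMinus2 G r s 2) x≡Ua e (dcColouring dc))
    byPosition (inj₂ e) = rim-not-dc (prev a) (subst₂ (λ r s → ColouringMinus2 G r s 2) e
      (trans x≡Ua (U-cong a (suc (prev a)) (≡-sym (suc-prev a)))) (swapMinus2 {G = G} (dcColouring dc)))

  dc-at-v : ∀ x y → DoubleCritical G x y → Mem v (x , y)
  dc-at-v x y dc with Mem? v (x , y)
  ... | yes v∈ = v∈
  ... | no v∉ = ⊥-elim (rim-dc-absurd x y (λ e → v∉ (inj₁ (≡-sym e))) (λ e → v∉ (inj₂ (≡-sym e))) dc)

  star : ∀ i → Mem v (E i)
  star i = recover (Inverse.to g i) (λ e p → dc-at-v (proj₁ e) (proj₂ e) (proj₂ p)) (Mem? v)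

  -- Every spoke v (U a) is double-critical: G - v - U a is the path
  -- U (a + 1), …, U (a + k), 2-coloured by the parity of the position
  -- R x = (x + k - a) mod P, which runs through 0, …, k - 1 along the path.
  module Spoke (a : ℕ) where
    R : ℕ → ℕ
    R x = (x + (k ∸ a % P)) % P

    parity : ℕ → Fin 2
    parity r = fromℕ< (DM.m%n<n r 2)

    parity-suc : ∀ r → parity (suc r) ≢ parity r
    parity-suc r e = parity-suc≢ r (trans (≡-sym (FP.toℕ-fromℕ< (DM.m%n<n (suc r) 2))) (trans (cong toℕ e) (FP.toℕ-fromℕ< (DM.m%n<n r 2))))

    R-cong : ∀ x y → x % P ≡ y % P → R x ≡ R y
    R-cong x y e = trans (≡-sym (%-+ˡ x _)) (trans (cong (λ r → (r + (k ∸ a % P)) % P) e) (%-+ˡ y _))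

    R≡k : ∀ x → R x ≡ k → U x ≡ U a
    R≡k x e = U-cong x a (shift-to-top (x % P) (a % P) (DM.m%n<n x P) (s≤s⁻¹ (DM.m%n<n a P)) (trans (%-+ˡ x _) e))

    R-suc : ∀ x → U x ≢ U a → R (suc x) ≡ suc (R x)
    R-suc x ne = trans (≡-sym (%-suc (x + (k ∸ a % P))))
      (DM.m<n⇒m%n≡m (s≤s (≤∧≢⇒< (s≤s⁻¹ (DM.m%n<n (x + (k ∸ a % P)) P)) (λ e → ne (R≡k x e)))))

    colour : (z : Fin n) → minus2 v (U a) z → Fin 2
    colour z s = parity (R (index z (proj₁ s)))

    step : ∀ x x' → U x ≢ U a → x' % P ≡ suc x % P → parity (R x') ≢ parity (R x)
    step x x' ne e = subst (λ r → parity r ≢ parity (R x)) (≡-sym (trans (R-cong x' (suc x) e) (R-suc x ne))) (parity-suc (R x))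

    proper : ∀ z z' (s : minus2 v (U a) z) (s' : minus2 v (U a) z') → T (adj G z z') → colour z s ≢ colour z' s'
    proper z z' s s' zz' with ⇒ (U-adj (index z (proj₁ s)) (index z' (proj₁ s')))
                              (subst₂ (λ p q → T (adj G p q)) (≡-sym (U-index z (proj₁ s))) (≡-sym (U-index z' (proj₁ s'))) zz')
    ... | inj₁ e = λ q → step (index z (proj₁ s)) (index z' (proj₁ s')) (λ q' → proj₂ s (trans (≡-sym (U-index z (proj₁ s))) q')) e (≡-sym q)
    ... | inj₂ e = step (index z' (proj₁ s')) (index z (proj₁ s)) (λ q' → proj₂ s' (trans (≡-sym (U-index z' (proj₁ s'))) q')) e

    χ≡2 : HasChromatic G (minus2 v (U a)) 2
    χ≡2 = (colour , proper) , not-fewer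
      where
      s₁ : minus2 v (U a) (U (1 + a))
      s₁ = U≢v (1 + a) , U-shift≢ a 1 (s≤s z≤n) 1<P
      s₂ : minus2 v (U a) (U (2 + a))
      s₂ = U≢v (2 + a) , U-shift≢ a 2 (s≤s z≤n) 2<P
      fin1 : ∀ (i j : Fin 1) → i ≡ j
      fin1 zero zero = refl
      -- the edge U (a + 1) U (a + 2) survives
      not-fewer : ∀ j → j < 2 → ¬ Colourable G (minus2 v (U a)) j
      not-fewer zero _ (c , _) = FP.¬Fin0 (c _ s₁)
      not-fewer (suc zero) _ (c , p) = p _ _ s₁ s₂ (adj-suc (1 + a)) (fin1 _ _)
      not-fewer (suc (suc j)) (s≤s (s≤s ())) _

    dc : DoubleCritical G v (U a)
    dc = v-dominating _ (U≢v a) , 4 , proj₁ cr , χ≡2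

    dc-reversed : DoubleCritical G (U a) v
    dc-reversed = adj-sym G (v-dominating _ (U≢v a)) , 4 , proj₁ cr ,
      (swapColourable {G = G} (proj₁ χ≡2) , λ j lt c → proj₂ χ≡2 j lt (swapColourable {G = G} c))

  spoke-edge : ∀ y → y ≢ v → DCEdge G
  spoke-edge y y≢v with <-cmp (toℕ v) (toℕ y)
  ... | tri< lt _ _ = ⟨ (v , y) , (lt , subst (DoubleCritical G v) (U-index y y≢v) (Spoke.dc (index y y≢v))) ⟩
  ... | tri≈ _ e _ = ⊥-elim (y≢v (≡-sym (FP.toℕ-injective e)))
  ... | tri> _ _ gt = ⟨ (y , v) , (gt , subst (λ r → DoubleCritical G r v) (U-index y y≢v) (Spoke.dc-reversed (index y y≢v))) ⟩

  spoke-edge-mem : ∀ y y≢v → Mem y (elt (spoke-edge y y≢v)) × Mem v (elt (spoke-edge y y≢v))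
  spoke-edge-mem y y≢v with <-cmp (toℕ v) (toℕ y)
  ... | tri< _ _ _ = inj₂ refl , inj₁ refl
  ... | tri≈ _ e _ = ⊥-elim (y≢v (≡-sym (FP.toℕ-injective e)))
  ... | tri> _ _ _ = inj₁ refl , inj₂ refl

  spoke-index : ∀ y → y ≢ v → Fin d
  spoke-index y y≢v = Inverse.from g (spoke-edge y y≢v)

  spoke-index-injective : ∀ y y' y≢v y'≢v → spoke-index y y≢v ≡ spoke-index y' y'≢v → y ≡ y'
  spoke-index-injective y y' y≢v y'≢v e =
    other-member-unique (elt (spoke-edge y' y'≢v)) (subst (λ r → Mem y (elt r)) same (proj₁ (spoke-edge-mem y y≢v)))
      (proj₁ (spoke-edge-mem y' y'≢v)) (proj₂ (spoke-edge-mem y' y'≢v)) y≢v y'≢v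
    where
    same : spoke-edge y y≢v ≡ spoke-edge y' y'≢v
    same = trans (≡-sym (Inverse.inverseˡ g refl)) (trans (cong (Inverse.to g) e) (Inverse.inverseˡ g refl))

  open StarAt v star

  deg-v : deg v ≡ n ∸ 1
  deg-v = trans (≡-sym (degree≡count G v)) degree-v

  d≡deg : d ≡ deg v
  d≡deg = ≤-antisym d≤deg (subst (_≤ d) (≡-sym deg-v) (injection-from-others v spoke-index spoke-index-injective))

  rest≡ : ∑ rest + 3 ≡ n * 3
  rest≡ = trans (≡-sym rest+3) (trans (∑-ext pointwise) (∑-const {n} 3))
    where
    pointwise : ∀ y → rest y + ind (δ v y) * 3 ≡ 3
    pointwise y with v ≟ y
    ... | yes refl = refl
    ... | no v≢y = trans (+-identityʳ _) (deg-rim y (≢-sym v≢y))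

  1+deg≡n : suc (deg v) ≡ n
  1+deg≡n = trans (cong suc deg-v) (1+[n-1] v)
    where
    1+[n-1] : ∀ {m} → Fin m → suc (m ∸ 1) ≡ m
    1+[n-1] {suc m} _ = refl

  equality : 2 * d ≡ edgeCount G
  equality = star-bound-attained d (deg v) (∑ rest) n (edgeCount G) d≡deg 1+deg≡n rest≡ deg+rest

theorem19 : ∀ {n} (G : Graph n) → Critical 4 G → NonComplete G →
    ∀ (d : ℕ) → HasSize (DCEdge G) d →
    (2 * d ≤ edgeCount G) ×
    ((2 * d ≡ edgeCount G) ⇔
      (∃ λ (v : Fin n) → degree G v ≡ n ∸ 1 × GminusVIsOddCycle≥5 G v))
theorem19 G cr nc d g =
  DoubleCriticalEdges.inequality G cr nc d g ,
  mk⇔ (EqualityCase.equality⇒wheel G cr nc d g)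
      (λ { (v , degree-v , k , 5≤P , _ , f , cycle) → Wheel.equality G cr nc d g v degree-v k 5≤P f cycle })
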